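{- For all integers $n\ge 1$, $r\ge 2$, $s\ge 1$, $\chi_{la}\big(r((2s)P_2\vee O_{2n})\big)=3$.
   Context: For a graph $G$ with $q$ edges, a local antimagic labeling is a bijection $f:E(G)\to\{1,\dots,q\}$ such that, writing $f^+(u)=\sum_{e\ni u}f(e)$, we have $f^+(u)\ne f^+(v)$ for every edge $uv$. $\chi_{la}(G)$ is the minimum over all local antimagic labelings of the number of distinct values of $f^+$. $aP_2$ is the disjoint union of $a$ copies of the one-edge path $P_2$, $O_m$ is the edgeless graph on $m$ vertices, $\vee$ denotes the join, and $rH$ denotes the disjoint union of $r$ copies of $H$. -}

module Defs where

open import Data.Nat using (ℕ; zero; suc; _+_; _*_; _≤_)
open import Data.Nat.Properties using () renaming (_≟_ to _≟ℕ_)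
open import Data.Fin using (Fin; toℕ; _↑ˡ_; _↑ʳ_) renaming (_≟_ to _≟F_)
open import Data.Nat.ListAction using (sum)
open import Data.List using (List; []; _∷_; _++_; map; length; lookup; allFin; deduplicate; concatMap)
open import Data.Product using (_×_; _,_; proj₁; proj₂; Σ)
open import Data.Bool using (Bool; _∨_; if_then_else_)
open import Relation.Nullary using (¬_)
open import Relation.Nullary.Decidable using (⌊_⌋)
open import Relation.Binary.PropositionalEquality using (_≡_)
open import Function.Bundles using (_⤖_; Bijection)

record Graph : Set where
  field
    V : ℕ
    E : List (Fin V × Fin V)
open Graph public

q : Graph → ℕ
q G = length (E G)

ends : (G : Graph) → Fin (q G) → Fin (V G) × Fin (V G)
ends G e = lookup (E G) e

-- A labeling is a bijection E(G) → {1,…,q}; realised as a bijection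
-- Fin q ⤖ Fin q, edge e receiving the label toℕ (f e) + 1.
Labeling : Graph → Set
Labeling G = Fin (q G) ⤖ Fin (q G)

label : (G : Graph) → Labeling G → Fin (q G) → ℕ
label G f e = suc (toℕ (Bijection.to f e))

incident : (G : Graph) → Fin (q G) → Fin (V G) → Bool
incident G e u = ⌊ proj₁ (ends G e) ≟F u ⌋ ∨ ⌊ proj₂ (ends G e) ≟F u ⌋

vsum : (G : Graph) → Labeling G → Fin (V G) → ℕ
vsum G f u = sum (map (λ e → if incident G e u then label G f e else 0) (allFin (q G)))

IsLocalAntimagic : (G : Graph) → Labeling G → Set
IsLocalAntimagic G f = (e : Fin (q G)) →
  ¬ (vsum G f (proj₁ (ends G e)) ≡ vsum G f (proj₂ (ends G e)))

numColors : (G : Graph) → Labeling G → ℕ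
numColors G f = length (deduplicate _≟ℕ_ (map (vsum G f) (allFin (V G))))

ChiLaEq : Graph → ℕ → Set
ChiLaEq G k =
  Σ (Labeling G) (λ f → Σ (IsLocalAntimagic G f) (λ _ → numColors G f ≡ k))
  × ((f : Labeling G) → IsLocalAntimagic G f → k ≤ numColors G f)

P₂ : Graph
P₂ = record { V = 2 ; E = (Fin.zero , Fin.suc Fin.zero) ∷ [] }

O : ℕ → Graph
O m = record { V = m ; E = [] }

private
  embL : ∀ {a} b → Fin a × Fin a → Fin (a + b) × Fin (a + b)
  embL b (x , y) = (x ↑ˡ b , y ↑ˡ b)
  embR : ∀ a {b} → Fin b × Fin b → Fin (a + b) × Fin (a + b)
  embR a (x , y) = (a ↑ʳ x , a ↑ʳ y)

_⊕_ : Graph → Graph → Graph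
G ⊕ H = record
  { V = V G + V H
  ; E = map (embL (V H)) (E G) ++ map (embR (V G)) (E H) }

_∨ᵍ_ : Graph → Graph → Graph
G ∨ᵍ H = record
  { V = V G + V H
  ; E = map (embL (V H)) (E G) ++ map (embR (V G)) (E H)
        ++ concatMap (λ u → map (λ v → (u ↑ˡ V H , V G ↑ʳ v)) (allFin (V H))) (allFin (V G)) }

copies : ℕ → Graph → Graph
copies zero H = O 0
copies (suc r) H = H ⊕ copies r H

-- Lower bound: an edge of (2s)P₂ and a vertex of O_{2n} span a triangle, so every local antimagic
-- labeling has at least three distinct vertex sums.
--
-- Upper bound: cut the edges into rs blocks, each made of two matching edges x₀y₀, x₁y₁ of one copy
-- together with their 8n edges to O_{2n}. It suffices to label all blocks bijectively so that inside
-- every block both xᵢ get the same sum A, both yᵢ the same sum B, and the four edges from {x₀, y₀, x₁, y₁}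
-- to any vertex of O_{2n} the same sum κ: then the x's sum to A, the y's to B and O_{2n} to sκ, three
-- values as soon as A, B and sκ differ. Bijectivity is certified by a decoder recovering from each
-- label the edge that carries it. For n = 1 the labels 1 + 5β + ρ are placed by hand, pairing block h
-- with the mirror block rs − 1 − h. For n ≥ 2 the labels form the complementary pairs {z, C − z} with
-- C = 2rs(4n + 1) + 1; the y's and O_{2n} receive complements of what the x's receive, so only the
-- x-sums need balancing.

module Submission where

open import Defs
open import Data.Bool using (Bool; true; false; not; _∨_; _xor_; if_then_else_)
open import Data.Bool.Properties using (xor-same)
open import Data.Empty using (⊥-elim)
open import Data.Fin using (Fin; toℕ; fromℕ<; _↑ˡ_; _↑ʳ_; punchOut; splitAt; join)
  renaming (zero to fzero; suc to fsuc; _≟_ to _≟ᶠ_)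
open import Data.Fin.Properties
  using (↑ˡ-injective; ↑ʳ-injective; toℕ-↑ˡ; toℕ-↑ʳ; toℕ<n; toℕ-fromℕ<; join-splitAt; any?; injective⇒≤; punchOut-injective)
import Data.List as List
open import Data.List using (List; []; _∷_; _++_; map; concat; length; lookup; tabulate; allFin; applyUpTo; concatMap; deduplicate)
open import Data.List.Properties
  using (length-++; length-map; length-applyUpTo; map-++; map-∘; map-cong; map-tabulate; map-applyUpTo; map-concatMap;
         tabulate-lookup; tabulate-cong)
open import Data.List.Membership.Propositional using (_∈_)
open import Data.List.Membership.Propositional.Properties
  using (∈-lookup; ∈-deduplicate⁺; ∈-deduplicate⁻; ∈-map⁺; ∈-map⁻; ∈-allFin; ∈-++⁺ˡ; ∈-++⁺ʳ; ∈-concat⁺′)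
open import Data.List.Relation.Binary.Subset.Propositional using (_⊆_)
open import Data.List.Relation.Unary.All as All using (All; []; _∷_)
open import Data.List.Relation.Unary.All.Properties using (++⁺; map⁺; concat⁺; applyUpTo⁺₁)
open import Data.List.Relation.Unary.AllPairs using ([]; _∷_)
open import Data.List.Relation.Unary.Any using (here; there; index)
open import Data.List.Relation.Unary.Any.Properties using (lookup-index)
open import Data.List.Relation.Unary.Unique.Propositional using (Unique)
import Data.List.Relation.Unary.Unique.Propositional.Properties as Unique
open import Data.List.Relation.Unary.Unique.DecPropositional.Properties using (deduplicate-!)
open import Data.Nat using (ℕ; zero; suc; _+_; _*_; _∸_; _≤_; _<_; z≤n; s≤s; pred; ⌊_/2⌋; _/_; _%_; NonZero; _<?_; _≤?_)
  renaming (_≟_ to _≟ℕ_)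
open import Data.Nat.DivMod using (m≡m%n+[m/n]*n; m%n<n)
open import Data.Nat.ListAction using (sum)
open import Data.Nat.Properties
open import Data.Nat.Tactic.RingSolver using (solve)
open import Algebra.Properties.CommutativeSemigroup +-commutativeSemigroup using (interchange)
open import Data.Product using (_×_; _,_; proj₁; proj₂; Σ; ∃; ∃-syntax)
open import Data.Sum using (_⊎_; inj₁; inj₂; [_,_]′)
open import Data.Unit using (⊤)
open import Function using (_∘_)
open import Function.Bundles using (_⤖_; Bijection; mk⤖)
open import Function.Definitions using (Injective)
open import Relation.Binary.PropositionalEquality
open import Relation.Nullary using (¬_; yes; no)
open import Relation.Nullary.Decidable using (Dec; ⌊_⌋; isYes≗does; dec-true; dec-false)

-- Vertex sums

⌊⌋-true : ∀ {p} {P : Set p} (d : Dec P) → P → ⌊ d ⌋ ≡ true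
⌊⌋-true d p = trans (isYes≗does d) (dec-true d p)

⌊⌋-false : ∀ {p} {P : Set p} (d : Dec P) → ¬ P → ⌊ d ⌋ ≡ false
⌊⌋-false d ¬p = trans (isYes≗does d) (dec-false d ¬p)

endsAt : ∀ {V} → Fin V × Fin V → Fin V → Bool
endsAt (a , b) u = ⌊ a ≟ᶠ u ⌋ ∨ ⌊ b ≟ᶠ u ⌋

incidentSum : ∀ {V} → List (Fin V × Fin V) → List ℕ → Fin V → ℕ
incidentSum []       _        u = 0
incidentSum (_ ∷ _)  []       u = 0
incidentSum (e ∷ es) (l ∷ ls) u = (if endsAt e u then l else 0) + incidentSum es ls u

vsum≡incidentSum : (G : Graph) (f : Labeling G) (u : Fin (V G)) →
  vsum G f u ≡ incidentSum (E G) (tabulate (label G f)) u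
vsum≡incidentSum G f u = trans (cong sum (map-tabulate {n = q G} (λ e → e) _)) (go (E G) (label G f))
  where
  go : (es : List (Fin (V G) × Fin (V G))) (l : Fin (length es) → ℕ) →
    sum (tabulate (λ e → if endsAt (lookup es e) u then l e else 0)) ≡ incidentSum es (tabulate l) u
  go []       l = refl
  go (e ∷ es) l = cong ((if endsAt e u then l fzero else 0) +_) (go es (l ∘ fsuc))

incidentSum-++ : ∀ {V} (es es′ : List (Fin V × Fin V)) (ls ls′ : List ℕ) u → length ls ≡ length es →
  incidentSum (es ++ es′) (ls ++ ls′) u ≡ incidentSum es ls u + incidentSum es′ ls′ u
incidentSum-++ []       es′ []       ls′ u _  = refl
incidentSum-++ (e ∷ es) es′ (l ∷ ls) ls′ u eq =
  trans (cong ((if endsAt e u then l else 0) +_) (incidentSum-++ es es′ ls ls′ u (suc-injective eq)))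
        (sym (+-assoc (if endsAt e u then l else 0) _ _))

mapEdge : ∀ {a b} → (Fin a → Fin b) → Fin a × Fin a → Fin b × Fin b
mapEdge f (x , y) = f x , f y

module _ {a b} {f : Fin a → Fin b} where

  ⌊≟⌋-injective : Injective _≡_ _≡_ f → ∀ i j → ⌊ f i ≟ᶠ f j ⌋ ≡ ⌊ i ≟ᶠ j ⌋
  ⌊≟⌋-injective inj i j with i ≟ᶠ j
  ... | yes refl = ⌊⌋-true (f i ≟ᶠ f i) refl
  ... | no  i≢j  = ⌊⌋-false (f i ≟ᶠ f j) (i≢j ∘ inj)

  endsAt-mapEdge : Injective _≡_ _≡_ f → ∀ e x → endsAt (mapEdge f e) (f x) ≡ endsAt e x
  endsAt-mapEdge inj (x , y) z = cong₂ _∨_ (⌊≟⌋-injective inj x z) (⌊≟⌋-injective inj y z)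

  endsAt-mapEdge-∉ : ∀ {u} → (∀ x → f x ≢ u) → ∀ e → endsAt (mapEdge f e) u ≡ false
  endsAt-mapEdge-∉ {u} ∉ (x , y) rewrite ⌊⌋-false (f x ≟ᶠ u) (∉ x) | ⌊⌋-false (f y ≟ᶠ u) (∉ y) = refl

  incidentSum-mapEdge : Injective _≡_ _≡_ f → ∀ es ls x →
    incidentSum (map (mapEdge f) es) ls (f x) ≡ incidentSum es ls x
  incidentSum-mapEdge inj []       ls       x = refl
  incidentSum-mapEdge inj (e ∷ es) []       x = refl
  incidentSum-mapEdge inj (e ∷ es) (l ∷ ls) x
    rewrite endsAt-mapEdge inj e x = cong (_ +_) (incidentSum-mapEdge inj es ls x)

  incidentSum-mapEdge-∉ : ∀ {u} → (∀ x → f x ≢ u) → ∀ es ls → incidentSum (map (mapEdge f) es) ls u ≡ 0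
  incidentSum-mapEdge-∉ ∉ []       ls       = refl
  incidentSum-mapEdge-∉ ∉ (e ∷ es) []       = refl
  incidentSum-mapEdge-∉ ∉ (e ∷ es) (l ∷ ls) rewrite endsAt-mapEdge-∉ ∉ e = incidentSum-mapEdge-∉ ∉ es ls

↑ˡ≢↑ʳ : ∀ {m n} (i : Fin m) (j : Fin n) → i ↑ˡ n ≢ m ↑ʳ j
↑ˡ≢↑ʳ {m} {n} i j eq = <⇒≢ (<-≤-trans (toℕ<n i) (m≤m+n m (toℕ j)))
  (trans (sym (toℕ-↑ˡ i n)) (trans (cong toℕ eq) (toℕ-↑ʳ m j)))

module _ (G H : Graph) {lG lH : List ℕ} (len : length lG ≡ q G) where

  ⊕-incidentSumˡ : ∀ x → incidentSum (E (G ⊕ H)) (lG ++ lH) (x ↑ˡ V H) ≡ incidentSum (E G) lG x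
  ⊕-incidentSumˡ x = begin
    incidentSum (E (G ⊕ H)) (lG ++ lH) (x ↑ˡ V H)
      ≡⟨ incidentSum-++ (map (mapEdge (_↑ˡ V H)) (E G)) _ lG lH _ (trans len (sym (length-map _ (E G)))) ⟩
    incidentSum (map (mapEdge (_↑ˡ V H)) (E G)) lG (x ↑ˡ V H) + incidentSum (map (mapEdge (V G ↑ʳ_)) (E H)) lH (x ↑ˡ V H)
      ≡⟨ cong₂ _+_ (incidentSum-mapEdge (↑ˡ-injective (V H) _ _) (E G) lG x)
                   (incidentSum-mapEdge-∉ (λ y eq → ↑ˡ≢↑ʳ x y (sym eq)) (E H) lH) ⟩
    incidentSum (E G) lG x + 0
      ≡⟨ +-identityʳ _ ⟩
    incidentSum (E G) lG x ∎
    where open ≡-Reasoning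

  ⊕-incidentSumʳ : ∀ y → incidentSum (E (G ⊕ H)) (lG ++ lH) (V G ↑ʳ y) ≡ incidentSum (E H) lH y
  ⊕-incidentSumʳ y =
    trans (incidentSum-++ (map (mapEdge (_↑ˡ V H)) (E G)) _ lG lH _ (trans len (sym (length-map _ (E G)))))
          (cong₂ _+_ (incidentSum-mapEdge-∉ (λ x → ↑ˡ≢↑ʳ x y) (E G) lG)
                     (incidentSum-mapEdge (↑ʳ-injective (V G) _ _) (E H) lH y))

sum-indicator : ∀ {n} (g : Fin n → ℕ) (x : Fin n) →
  sum (map (λ u → if ⌊ u ≟ᶠ x ⌋ then g u else 0) (allFin n)) ≡ g x
sum-indicator {n} g x = trans (cong sum (map-tabulate {n = n} (λ u → u) _)) (go g x)
  where
  go : ∀ {n} (g : Fin n → ℕ) (x : Fin n) → sum (tabulate (λ u → if ⌊ u ≟ᶠ x ⌋ then g u else 0)) ≡ g x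
  go {suc n} g fzero    = trans (cong (g fzero +_) (zeros n)) (+-identityʳ _)
    where
    zeros : ∀ n → sum (tabulate {n = n} (λ _ → 0)) ≡ 0
    zeros zero    = refl
    zeros (suc n) = zeros n
  go {suc n} g (fsuc x) = trans (cong sum (tabulate-cong (λ u → cong (λ b → if b then g (fsuc u) else 0) (⌊suc≟suc⌋ u))))
                                (go (g ∘ fsuc) x)
    where
    ⌊suc≟suc⌋ : ∀ u → ⌊ fsuc u ≟ᶠ fsuc x ⌋ ≡ ⌊ u ≟ᶠ x ⌋
    ⌊suc≟suc⌋ u with u ≟ᶠ x
    ... | yes _ = refl
    ... | no  _ = refl

joinLabels : ∀ {a m} → (Fin a → Fin m → ℕ) → List ℕ
joinLabels {a} {m} J = concatMap (λ u → map (J u) (allFin m)) (allFin a)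

module _ {a m : ℕ} where

  private
    row : Fin a → List (Fin m) → List (Fin (a + m) × Fin (a + m))
    row u = map (λ v → u ↑ˡ m , a ↑ʳ v)

    row-at-↑ˡ : ∀ u x vs (g : Fin m → ℕ) →
      incidentSum (row u vs) (map g vs) (x ↑ˡ m) ≡ (if ⌊ u ≟ᶠ x ⌋ then sum (map g vs) else 0)
    row-at-↑ˡ u x [] g with ⌊ u ≟ᶠ x ⌋
    ... | true  = refl
    ... | false = refl
    row-at-↑ˡ u x (v ∷ vs) g
      rewrite ⌊≟⌋-injective (↑ˡ-injective m _ _) u x
            | ⌊⌋-false (a ↑ʳ v ≟ᶠ x ↑ˡ m) (λ eq → ↑ˡ≢↑ʳ x v (sym eq))
            | row-at-↑ˡ u x vs g
      with ⌊ u ≟ᶠ x ⌋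
    ... | true  = refl
    ... | false = refl

    row-at-↑ʳ : ∀ u y vs (g : Fin m → ℕ) →
      incidentSum (row u vs) (map g vs) (a ↑ʳ y) ≡ sum (map (λ v → if ⌊ v ≟ᶠ y ⌋ then g v else 0) vs)
    row-at-↑ʳ u y []       g = refl
    row-at-↑ʳ u y (v ∷ vs) g
      rewrite ⌊⌋-false (u ↑ˡ m ≟ᶠ a ↑ʳ y) (↑ˡ≢↑ʳ u y) | ⌊≟⌋-injective (↑ʳ-injective a _ _) v y =
      cong (_ +_) (row-at-↑ʳ u y vs g)

    rows-++ : ∀ u us vs (J : Fin a → Fin m → ℕ) w →
      incidentSum (row u vs ++ concatMap (λ u → row u vs) us) (map (J u) vs ++ concatMap (λ u → map (J u) vs) us) w
      ≡ incidentSum (row u vs) (map (J u) vs) w + incidentSum (concatMap (λ u → row u vs) us) (concatMap (λ u → map (J u) vs) us) w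
    rows-++ u us vs J w = incidentSum-++ (row u vs) _ (map (J u) vs) _ w (trans (length-map (J u) vs) (sym (length-map _ vs)))

  joinRows-at-↑ˡ : ∀ us vs (J : Fin a → Fin m → ℕ) x →
    incidentSum (concatMap (λ u → row u vs) us) (concatMap (λ u → map (J u) vs) us) (x ↑ˡ m)
    ≡ sum (map (λ u → if ⌊ u ≟ᶠ x ⌋ then sum (map (J u) vs) else 0) us)
  joinRows-at-↑ˡ []       vs J x = refl
  joinRows-at-↑ˡ (u ∷ us) vs J x =
    trans (rows-++ u us vs J (x ↑ˡ m)) (cong₂ _+_ (row-at-↑ˡ u x vs (J u)) (joinRows-at-↑ˡ us vs J x))

  joinRows-at-↑ʳ : ∀ us vs (J : Fin a → Fin m → ℕ) y →
    incidentSum (concatMap (λ u → row u vs) us) (concatMap (λ u → map (J u) vs) us) (a ↑ʳ y)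
    ≡ sum (map (λ u → sum (map (λ v → if ⌊ v ≟ᶠ y ⌋ then J u v else 0) vs)) us)
  joinRows-at-↑ʳ []       vs J y = refl
  joinRows-at-↑ʳ (u ∷ us) vs J y =
    trans (rows-++ u us vs J (a ↑ʳ y)) (cong₂ _+_ (row-at-↑ʳ u y vs (J u)) (joinRows-at-↑ʳ us vs J y))

module _ (G : Graph) (m : ℕ) {lG : List ℕ} (len : length lG ≡ q G) (J : Fin (V G) → Fin m → ℕ) where

  private
    split : ∀ w → incidentSum (E (G ∨ᵍ O m)) (lG ++ joinLabels J) w
      ≡ incidentSum (map (mapEdge (_↑ˡ m)) (E G)) lG w
        + incidentSum (concatMap (λ u → map (λ v → u ↑ˡ m , V G ↑ʳ v) (allFin m)) (allFin (V G))) (joinLabels J) w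
    split w = incidentSum-++ (map (mapEdge (_↑ˡ m)) (E G)) _ lG (joinLabels J) w (trans len (sym (length-map _ (E G))))

  ∨O-incidentSumˡ : ∀ x →
    incidentSum (E (G ∨ᵍ O m)) (lG ++ joinLabels J) (x ↑ˡ m) ≡ incidentSum (E G) lG x + sum (map (J x) (allFin m))
  ∨O-incidentSumˡ x = trans (split (x ↑ˡ m))
    (cong₂ _+_ (incidentSum-mapEdge (↑ˡ-injective m _ _) (E G) lG x)
               (trans (joinRows-at-↑ˡ (allFin (V G)) (allFin m) J x) (sum-indicator (λ u → sum (map (J u) (allFin m))) x)))

  ∨O-incidentSumʳ : ∀ y →
    incidentSum (E (G ∨ᵍ O m)) (lG ++ joinLabels J) (V G ↑ʳ y) ≡ sum (map (λ u → J u y) (allFin (V G)))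
  ∨O-incidentSumʳ y = trans (split (V G ↑ʳ y))
    (cong₂ _+_ (incidentSum-mapEdge-∉ (λ x → ↑ˡ≢↑ʳ x y) (E G) lG)
               (trans (joinRows-at-↑ʳ (allFin (V G)) (allFin m) J y)
                      (cong sum (map-cong (λ u → sum-indicator (J u) y) (allFin (V G))))))

length-concatMap-map : ∀ {A B C : Set} (f : A → B → C) (us : List A) (vs : List B) →
  length (concatMap (λ u → map (f u) vs) us) ≡ length us * length vs
length-concatMap-map f []       vs = refl
length-concatMap-map f (u ∷ us) vs =
  trans (length-++ (map (f u) vs)) (cong₂ _+_ (length-map (f u) vs) (length-concatMap-map f us vs))

length-∨O : ∀ G m {lG : List ℕ} (J : Fin (V G) → Fin m → ℕ) → length lG ≡ q G →
  length (lG ++ joinLabels J) ≡ q (G ∨ᵍ O m)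
length-∨O G m {lG} J len = begin
  length (lG ++ joinLabels J)                        ≡⟨ length-++ lG ⟩
  length lG + length (joinLabels J)                  ≡⟨ cong₂ _+_ (trans len (sym (length-map _ (E G))))
                                                         (trans (length-concatMap-map J (allFin (V G)) (allFin m))
                                                                (sym (length-concatMap-map (λ u v → u ↑ˡ m , V G ↑ʳ v) (allFin (V G)) (allFin m)))) ⟩
  length (map (mapEdge (_↑ˡ m)) (E G)) + length (concatMap (λ u → map (λ v → u ↑ˡ m , V G ↑ʳ v) (allFin m)) (allFin (V G)))
                                                     ≡⟨ sym (length-++ (map (mapEdge (_↑ˡ m)) (E G))) ⟩
  q (G ∨ᵍ O m) ∎
  where open ≡-Reasoning

-- Labelings and their colours

lookup-injective : ∀ {A : Set} {xs : List A} → Unique xs → ∀ {i j} → lookup xs i ≡ lookup xs j → i ≡ j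
lookup-injective (x∉ ∷ u) {fzero}  {fzero}  eq = refl
lookup-injective (x∉ ∷ u) {fzero}  {fsuc j} eq = ⊥-elim (All.lookup x∉ (∈-lookup j) eq)
lookup-injective (x∉ ∷ u) {fsuc i} {fzero}  eq = ⊥-elim (All.lookup x∉ (∈-lookup i) (sym eq))
lookup-injective (x∉ ∷ u) {fsuc i} {fsuc j} eq = cong fsuc (lookup-injective u eq)

unique-⊆⇒length≤ : ∀ {A : Set} {xs ys : List A} → Unique xs → xs ⊆ ys → length xs ≤ length ys
unique-⊆⇒length≤ {xs = xs} {ys} u xs⊆ys = injective⇒≤ {f = position} position-injective
  where
  position : Fin (length xs) → Fin (length ys)
  position i = index (xs⊆ys (∈-lookup i))
  position-injective : ∀ {i j} → position i ≡ position j → i ≡ j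
  position-injective {i} {j} eq = lookup-injective u
    (trans (lookup-index (xs⊆ys (∈-lookup i))) (trans (cong (lookup ys) eq) (sym (lookup-index (xs⊆ys (∈-lookup j))))))

injective⇒surjective : ∀ {n} (f : Fin n → Fin n) → Injective _≡_ _≡_ f → ∀ y → ∃[ x ] f x ≡ y
injective⇒surjective {suc n} f inj y with any? (λ x → f x ≟ᶠ y)
... | yes hit = hit
... | no  miss = ⊥-elim (<-irrefl refl (injective⇒≤ {f = avoid} avoid-injective))
  where
  avoid : Fin (suc n) → Fin n
  avoid x = punchOut {i = y} {j = f x} (λ eq → miss (x , sym eq))
  avoid-injective : ∀ {x z} → avoid x ≡ avoid z → x ≡ z
  avoid-injective {x} {z} eq = inj (punchOut-injective (λ e → miss (x , sym e)) (λ e → miss (z , sym e)) eq)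

labelingFromList : (G : Graph) (ls : List ℕ) → length ls ≡ q G → Unique ls → All (λ l → 1 ≤ l × l ≤ q G) ls →
  Σ (Labeling G) λ f → tabulate (label G f) ≡ ls
labelingFromList G ls len u bounds = go (q G) len
  where
  go : ∀ m → length ls ≡ m → Σ (Fin m ⤖ Fin m) λ f → tabulate (λ e → suc (toℕ (Bijection.to f e))) ≡ ls
  go .(length ls) refl = mk⤖ (to-injective , to-surjective) , tabulate-to
    where
    inRange : ∀ i → 1 ≤ lookup ls i × lookup ls i ≤ length ls
    inRange i = subst (λ m → 1 ≤ lookup ls i × lookup ls i ≤ m) (sym len) (All.lookup bounds (∈-lookup i))
    pred< : ∀ i → pred (lookup ls i) < length ls
    pred< i with lookup ls i | inRange i
    ... | suc l | _ , l< = l<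
    to : Fin (length ls) → Fin (length ls)
    to i = fromℕ< (pred< i)
    suc-to : ∀ i → suc (toℕ (to i)) ≡ lookup ls i
    suc-to i rewrite toℕ-fromℕ< (pred< i) with lookup ls i | inRange i
    ... | suc l | _ = refl
    to-injective : ∀ {i j} → to i ≡ to j → i ≡ j
    to-injective {i} {j} eq = lookup-injective u (trans (sym (suc-to i)) (trans (cong (suc ∘ toℕ) eq) (suc-to j)))
    to-surjective : ∀ y → ∃ λ x → ∀ {z} → z ≡ x → to z ≡ y
    to-surjective y with injective⇒surjective to to-injective y
    ... | x , tx≡y = x , λ { refl → tx≡y }
    tabulate-to : tabulate (λ e → suc (toℕ (to e))) ≡ ls
    tabulate-to = trans (tabulate-cong suc-to) (tabulate-lookup ls)

Separating : ∀ {V} → List (Fin V × Fin V) → (Fin V → ℕ) → Set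
Separating es w = All (λ e → w (proj₁ e) ≢ w (proj₂ e)) es

separating⇒localAntimagic : (G : Graph) (f : Labeling G) → Separating (E G) (vsum G f) → IsLocalAntimagic G f
separating⇒localAntimagic G f sep e = All.lookup sep (∈-lookup e)

separating-cong : ∀ {V} {es : List (Fin V × Fin V)} {w w′ : Fin V → ℕ} →
  (∀ u → w u ≡ w′ u) → Separating es w → Separating es w′
separating-cong w≗w′ = All.map (λ {e} ne eq → ne (trans (w≗w′ (proj₁ e)) (trans eq (sym (w≗w′ (proj₂ e))))))

∨O-separating : ∀ G m (w : Fin (V (G ∨ᵍ O m)) → ℕ) → Separating (E G) (w ∘ (_↑ˡ m)) →
  (∀ u v → w (u ↑ˡ m) ≢ w (V G ↑ʳ v)) → Separating (E (G ∨ᵍ O m)) w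
∨O-separating G m w inG across = ++⁺ (map⁺ inG)
  (concat⁺ (map⁺ (All.universal (λ u → map⁺ (All.universal (across u) (allFin m))) (allFin (V G)))))

numColors≤3 : (G : Graph) (f : Labeling G) {A B C : ℕ} →
  (∀ u → vsum G f u ∈ A ∷ B ∷ C ∷ []) → numColors G f ≤ 3
numColors≤3 G f values = unique-⊆⇒length≤ (deduplicate-! _≟ℕ_ _) valueIn
  where
  valueIn : ∀ {x} → x ∈ deduplicate _≟ℕ_ (map (vsum G f) (allFin (V G))) → x ∈ _
  valueIn x∈ with ∈-map⁻ (vsum G f) (∈-deduplicate⁻ _≟ℕ_ (map (vsum G f) (allFin (V G))) x∈)
  ... | u , _ , refl = values u

Triangle : (G : Graph) → Fin (V G) → Fin (V G) → Fin (V G) → Set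
Triangle G t₁ t₂ t₃ = (t₁ , t₂) ∈ E G × (t₁ , t₃) ∈ E G × (t₂ , t₃) ∈ E G

triangle⇒3≤numColors : (G : Graph) {t₁ t₂ t₃ : Fin (V G)} → Triangle G t₁ t₂ t₃ →
  (f : Labeling G) → IsLocalAntimagic G f → 3 ≤ numColors G f
triangle⇒3≤numColors G {t₁} {t₂} {t₃} (e₁₂ , e₁₃ , e₂₃) f antimagic =
  unique-⊆⇒length≤ ((differ e₁₂ ∷ differ e₁₃ ∷ []) ∷ (differ e₂₃ ∷ []) ∷ [] ∷ []) corners⊆
  where
  differ : ∀ {a b} → (a , b) ∈ E G → vsum G f a ≢ vsum G f b
  differ p = subst (λ e → vsum G f (proj₁ e) ≢ vsum G f (proj₂ e)) (sym (lookup-index p)) (antimagic (index p))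
  sumAt∈ : ∀ t → vsum G f t ∈ deduplicate _≟ℕ_ (map (vsum G f) (allFin (V G)))
  sumAt∈ t = ∈-deduplicate⁺ _≟ℕ_ (∈-map⁺ (vsum G f) (∈-allFin t))
  corners⊆ : vsum G f t₁ ∷ vsum G f t₂ ∷ vsum G f t₃ ∷ [] ⊆ deduplicate _≟ℕ_ (map (vsum G f) (allFin (V G)))
  corners⊆ (here refl)                 = sumAt∈ t₁
  corners⊆ (there (here refl))         = sumAt∈ t₂
  corners⊆ (there (there (here refl))) = sumAt∈ t₃

∨O-triangle : ∀ G m {a b} → (a , b) ∈ E G → (v : Fin m) → Triangle (G ∨ᵍ O m) (a ↑ˡ m) (b ↑ˡ m) (V G ↑ʳ v)
∨O-triangle G m {a} {b} ab v = ∈-++⁺ˡ (∈-map⁺ (mapEdge (_↑ˡ m)) ab) , across a , across b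
  where
  across : ∀ u → (u ↑ˡ m , V G ↑ʳ v) ∈ E (G ∨ᵍ O m)
  across u = ∈-++⁺ʳ (map (mapEdge (_↑ˡ m)) (E G)) (∈-concat⁺′ (∈-map⁺ _ (∈-allFin v)) (∈-map⁺ _ (∈-allFin u)))

copies-triangle : ∀ H r {t₁ t₂ t₃} → Triangle H t₁ t₂ t₃ →
  Triangle (copies (suc r) H) (t₁ ↑ˡ V (copies r H)) (t₂ ↑ˡ V (copies r H)) (t₃ ↑ˡ V (copies r H))
copies-triangle H r (e₁₂ , e₁₃ , e₂₃) = inFirst e₁₂ , inFirst e₁₃ , inFirst e₂₃
  where
  inFirst : ∀ {e} → e ∈ E H → mapEdge (_↑ˡ V (copies r H)) e ∈ E (copies (suc r) H)
  inFirst p = ∈-++⁺ˡ (∈-map⁺ (mapEdge (_↑ˡ V (copies r H))) p)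

-- Disjoint copies

↑-elim : ∀ {m n} (P : Fin (m + n) → Set) → (∀ i → P (i ↑ˡ n)) → (∀ j → P (m ↑ʳ j)) → ∀ u → P u
↑-elim {m} {n} P left right u = subst P (join-splitAt m n u) (byCase (splitAt m u))
  where
  byCase : ∀ s → P (join m n s)
  byCase (inj₁ i) = left i
  byCase (inj₂ j) = right j

copiesLabels : ℕ → (ℕ → List ℕ) → List ℕ
copiesLabels zero    ls = []
copiesLabels (suc r) ls = ls 0 ++ copiesLabels r (ls ∘ suc)

module _ (H : Graph) where

  length-copiesLabels : ∀ r ls → (∀ k → length (ls k) ≡ q H) → length (copiesLabels r ls) ≡ q (copies r H)
  length-copiesLabels zero    ls len = refl
  length-copiesLabels (suc r) ls len = begin
    length (ls 0 ++ copiesLabels r (ls ∘ suc))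
      ≡⟨ length-++ (ls 0) ⟩
    length (ls 0) + length (copiesLabels r (ls ∘ suc))
      ≡⟨ cong₂ _+_ (trans (len 0) (sym (length-map _ (E H))))
                   (trans (length-copiesLabels r (ls ∘ suc) (len ∘ suc)) (sym (length-map _ (E (copies r H))))) ⟩
    length (map (mapEdge (_↑ˡ V (copies r H))) (E H)) + length (map (mapEdge (V H ↑ʳ_)) (E (copies r H)))
      ≡⟨ sym (length-++ (map (mapEdge (_↑ˡ V (copies r H))) (E H))) ⟩
    q (copies (suc r) H) ∎
    where open ≡-Reasoning

  copies-values : (P : ℕ → Set) → ∀ r ls → (∀ k → length (ls k) ≡ q H) →
    (∀ k → k < r → ∀ x → P (incidentSum (E H) (ls k) x)) →
    ∀ u → P (incidentSum (E (copies r H)) (copiesLabels r ls) u)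
  copies-values P (suc r) ls len inCopy = ↑-elim _
    (λ x → subst P (sym (⊕-incidentSumˡ H (copies r H) (len 0) x)) (inCopy 0 (s≤s z≤n) x))
    (λ y → subst P (sym (⊕-incidentSumʳ H (copies r H) (len 0) y))
                   (copies-values P r (ls ∘ suc) (len ∘ suc) (λ k k<r → inCopy (suc k) (s≤s k<r)) y))

  copies-separating : ∀ r ls → (∀ k → length (ls k) ≡ q H) →
    (∀ k → k < r → Separating (E H) (incidentSum (E H) (ls k))) →
    Separating (E (copies r H)) (incidentSum (E (copies r H)) (copiesLabels r ls))
  copies-separating zero    ls len inCopy = []
  copies-separating (suc r) ls len inCopy = ++⁺
    (map⁺ (separating-cong (λ x → sym (⊕-incidentSumˡ H (copies r H) (len 0) x)) (inCopy 0 (s≤s z≤n))))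
    (map⁺ (separating-cong (λ y → sym (⊕-incidentSumʳ H (copies r H) (len 0) y))
                           (copies-separating r (ls ∘ suc) (len ∘ suc) (λ k k<r → inCopy (suc k) (s≤s k<r)))))

-- The graph (2s)P₂ ∨ O_{2n}

tabulate-toℕ : ∀ {A : Set} m (f : ℕ → A) → tabulate {n = m} (f ∘ toℕ) ≡ applyUpTo f m
tabulate-toℕ zero    f = refl
tabulate-toℕ (suc m) f = cong (f 0 ∷_) (tabulate-toℕ m (f ∘ suc))

map-allFin : ∀ {A : Set} m (f : ℕ → A) → map (f ∘ toℕ) (allFin m) ≡ applyUpTo f m
map-allFin m f = trans (map-tabulate {n = m} (λ i → i) (f ∘ toℕ)) (tabulate-toℕ m f)

sumRange : (ℕ → ℕ) → ℕ → ℕ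
sumRange f n = sum (applyUpTo f n)

sum-allFin≡sumRange : ∀ n (f : ℕ → ℕ) → sum (map (f ∘ toℕ) (allFin n)) ≡ sumRange f n
sum-allFin≡sumRange n f = cong sum (map-allFin n f)

sumRange-const : ∀ n {f : ℕ → ℕ} c → (∀ i → i < n → f i ≡ c) → sumRange f n ≡ n * c
sumRange-const zero    c f≡c = refl
sumRange-const (suc n) c f≡c = cong₂ _+_ (f≡c 0 (s≤s z≤n)) (sumRange-const n c (λ i i<n → f≡c (suc i) (s≤s i<n)))

sumRange-+ : ∀ n (f g : ℕ → ℕ) → sumRange f n + sumRange g n ≡ sumRange (λ i → f i + g i) n
sumRange-+ zero    f g = refl
sumRange-+ (suc n) f g = trans (interchange (f 0) (sumRange (f ∘ suc) n) (g 0) (sumRange (g ∘ suc) n))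
                               (cong (f 0 + g 0 +_) (sumRange-+ n (f ∘ suc) (g ∘ suc)))

parity : ℕ → ℕ
parity 0             = 0
parity 1             = 1
parity (suc (suc n)) = parity n

parity<2 : ∀ n → parity n < 2
parity<2 0             = s≤s z≤n
parity<2 1             = s≤s (s≤s z≤n)
parity<2 (suc (suc n)) = parity<2 n

parity-cases : ∀ n → parity n ≡ 0 ⊎ parity n ≡ 1
parity-cases 0             = inj₁ refl
parity-cases 1             = inj₂ refl
parity-cases (suc (suc n)) = parity-cases n

⌊n/2⌋*2+parity≡n : ∀ n → ⌊ n /2⌋ * 2 + parity n ≡ n
⌊n/2⌋*2+parity≡n 0             = refl
⌊n/2⌋*2+parity≡n 1             = refl
⌊n/2⌋*2+parity≡n (suc (suc n)) = cong (suc ∘ suc) (⌊n/2⌋*2+parity≡n n)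

⌊k*2+e/2⌋ : ∀ k e → e < 2 → ⌊ k * 2 + e /2⌋ ≡ k × parity (k * 2 + e) ≡ e
⌊k*2+e/2⌋ zero    0 _ = refl , refl
⌊k*2+e/2⌋ zero    1 _ = refl , refl
⌊k*2+e/2⌋ zero    (suc (suc e)) (s≤s (s≤s ()))
⌊k*2+e/2⌋ (suc k) e e<2 with ⌊k*2+e/2⌋ k e e<2
... | half≡ , parity≡ = cong suc half≡ , parity≡

⌊n/2⌋<m : ∀ n m → n < 2 * m → ⌊ n /2⌋ < m
⌊n/2⌋<m n             zero    ()
⌊n/2⌋<m 0             (suc m) _ = s≤s z≤n
⌊n/2⌋<m 1             (suc m) _ = s≤s z≤n
⌊n/2⌋<m (suc (suc n)) (suc m) n< =
  s≤s (⌊n/2⌋<m n m (≤-pred (≤-pred (≤-trans n< (≤-reflexive (*-suc 2 m))))))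

sumRange-halves : ∀ n (g : ℕ → ℕ → ℕ) → sumRange (λ i → g ⌊ i /2⌋ (parity i)) (2 * n) ≡ sumRange (λ j → g j 0 + g j 1) n
sumRange-halves zero    g = refl
sumRange-halves (suc n) g rewrite +-suc n (n + 0) =
  trans (sym (+-assoc (g 0 0) (g 0 1) _)) (cong (g 0 0 + g 0 1 +_) (sumRange-halves n (g ∘ suc)))

V-copies-P₂ : ∀ l → V (copies l P₂) ≡ 2 * l
V-copies-P₂ zero    = refl
V-copies-P₂ (suc l) = trans (cong (2 +_) (V-copies-P₂ l)) (sym (*-suc 2 l))

-- Vertices 2i and 2i + 1 of lP₂ are the two ends of its i-th edge.
matching-incidentSum : ∀ l (M : ℕ → ℕ) x →
  incidentSum (E (copies l P₂)) (applyUpTo M l) x ≡ M ⌊ toℕ x /2⌋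
matching-incidentSum (suc l) M = ↑-elim _
  (λ i → trans (⊕-incidentSumˡ P₂ (copies l P₂) {M 0 ∷ []} {applyUpTo (M ∘ suc) l} refl i) (atEdge i))
  (λ j → trans (⊕-incidentSumʳ P₂ (copies l P₂) {M 0 ∷ []} {applyUpTo (M ∘ suc) l} refl j)
               (matching-incidentSum l (M ∘ suc) j))
  where
  atEdge : ∀ i → incidentSum (E P₂) (M 0 ∷ []) i ≡ M ⌊ toℕ (i ↑ˡ V (copies l P₂)) /2⌋
  atEdge fzero        = +-identityʳ (M 0)
  atEdge (fsuc fzero) = +-identityʳ (M 0)

matching-edges : ∀ l → All (λ e → parity (toℕ (proj₁ e)) ≡ 0 × parity (toℕ (proj₂ e)) ≡ 1) (E (copies l P₂))
matching-edges zero    = []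
matching-edges (suc l) = (refl , refl) ∷ map⁺ (matching-edges l)

sum-matchingVertices : ∀ l (g : ℕ → ℕ → ℕ) →
  sum (map (λ u → g ⌊ toℕ u /2⌋ (parity (toℕ u))) (allFin (V (copies l P₂)))) ≡ sumRange (λ i → g i 0 + g i 1) l
sum-matchingVertices l g = begin
  sum (map (λ u → g ⌊ toℕ u /2⌋ (parity (toℕ u))) (allFin (V (copies l P₂))))
    ≡⟨ sum-allFin≡sumRange (V (copies l P₂)) (λ t → g ⌊ t /2⌋ (parity t)) ⟩
  sumRange (λ t → g ⌊ t /2⌋ (parity t)) (V (copies l P₂))
    ≡⟨ cong (sumRange (λ t → g ⌊ t /2⌋ (parity t))) (V-copies-P₂ l) ⟩
  sumRange (λ t → g ⌊ t /2⌋ (parity t)) (2 * l)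
    ≡⟨ sumRange-halves l g ⟩
  sumRange (λ i → g i 0 + g i 1) l ∎
  where open ≡-Reasoning

module JoinGraph (n s : ℕ) where

  G H : Graph
  G = copies (2 * s) P₂
  H = G ∨ᵍ O (2 * n)

  component< : ∀ (x : Fin (V G)) → ⌊ toℕ x /2⌋ < 2 * s
  component< x = ⌊n/2⌋<m (toℕ x) (2 * s) (subst (toℕ x <_) (V-copies-P₂ (2 * s)) (toℕ<n x))

  atVertex : (ℕ → ℕ → ℕ → ℕ) → Fin (V G) → Fin (2 * n) → ℕ
  atVertex J u c = J ⌊ toℕ u /2⌋ (parity (toℕ u)) (toℕ c)

  -- M i labels the i-th matching edge, J i sd c the edge from its end sd to the c-th vertex of O_{2n}.
  copyLabels : (ℕ → ℕ) → (ℕ → ℕ → ℕ → ℕ) → List ℕ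
  copyLabels M J = applyUpTo M (2 * s) ++ joinLabels (atVertex J)

  module _ (M : ℕ → ℕ) (J : ℕ → ℕ → ℕ → ℕ) where

    private
      length-matching : length (applyUpTo M (2 * s)) ≡ q G
      length-matching = trans (length-applyUpTo M (2 * s)) (sym (edges (2 * s)))
        where
        edges : ∀ l → q (copies l P₂) ≡ l
        edges zero    = refl
        edges (suc l) = cong suc (trans (length-map _ (E (copies l P₂))) (edges l))

    length-copyLabels : length (copyLabels M J) ≡ q H
    length-copyLabels = length-∨O G (2 * n) {applyUpTo M (2 * s)} (atVertex J) length-matching

    copy-incidentSum-path : ∀ (x : Fin (V G)) →
      incidentSum (E H) (copyLabels M J) (x ↑ˡ 2 * n)
      ≡ M ⌊ toℕ x /2⌋ + sumRange (J ⌊ toℕ x /2⌋ (parity (toℕ x))) (2 * n)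
    copy-incidentSum-path x =
      trans (∨O-incidentSumˡ G (2 * n) {applyUpTo M (2 * s)} length-matching (atVertex J) x)
            (cong₂ _+_ (matching-incidentSum (2 * s) M x)
                       (sum-allFin≡sumRange (2 * n) (J ⌊ toℕ x /2⌋ (parity (toℕ x)))))

    copy-incidentSum-independent : ∀ (c : Fin (2 * n)) →
      incidentSum (E H) (copyLabels M J) (V G ↑ʳ c) ≡ sumRange (λ i → J i 0 (toℕ c) + J i 1 (toℕ c)) (2 * s)
    copy-incidentSum-independent c =
      trans (∨O-incidentSumʳ G (2 * n) {applyUpTo M (2 * s)} length-matching (atVertex J) c)
            (sum-matchingVertices (2 * s) (λ i sd → J i sd (toℕ c)))

    module _ {A B C : ℕ}
      (x-sum : ∀ i → i < 2 * s → M i + sumRange (J i 0) (2 * n) ≡ A)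
      (y-sum : ∀ i → i < 2 * s → M i + sumRange (J i 1) (2 * n) ≡ B)
      (z-sum : ∀ c → c < 2 * n → sumRange (λ i → J i 0 c + J i 1 c) (2 * s) ≡ C) where

      private
        sumAt : Fin (V H) → ℕ
        sumAt = incidentSum (E H) (copyLabels M J)

        atEnd : ∀ {sd X} (x : Fin (V G)) → parity (toℕ x) ≡ sd →
          (∀ i → i < 2 * s → M i + sumRange (J i sd) (2 * n) ≡ X) → sumAt (x ↑ˡ 2 * n) ≡ X
        atEnd x refl end-sum = trans (copy-incidentSum-path x) (end-sum _ (component< x))

        atPath : ∀ (x : Fin (V G)) → sumAt (x ↑ˡ 2 * n) ≡ A ⊎ sumAt (x ↑ˡ 2 * n) ≡ B
        atPath x with parity-cases (toℕ x)
        ... | inj₁ p = inj₁ (atEnd x p x-sum)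
        ... | inj₂ p = inj₂ (atEnd x p y-sum)

        atIndependent : ∀ (c : Fin (2 * n)) → sumAt (V G ↑ʳ c) ≡ C
        atIndependent c = trans (copy-incidentSum-independent c) (z-sum (toℕ c) (toℕ<n c))

      copy-values : ∀ u → sumAt u ∈ A ∷ B ∷ C ∷ []
      copy-values = ↑-elim _
        (λ x → [ here , there ∘ here ]′ (atPath x))
        (λ c → there (there (here (atIndependent c))))

      copy-separating : A ≢ B → A ≢ C → B ≢ C → Separating (E H) sumAt
      copy-separating A≢B A≢C B≢C = ∨O-separating G (2 * n) sumAt
        (All.map (λ {e} (x-end , y-end) eq → A≢B (trans (sym (atEnd (proj₁ e) x-end x-sum)) (trans eq (atEnd (proj₂ e) y-end y-sum))))
                 (matching-edges (2 * s)))
        differs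
        where
        differs : ∀ (u : Fin (V G)) (c : Fin (2 * n)) → sumAt (u ↑ˡ 2 * n) ≢ sumAt (V G ↑ʳ c)
        differs u c eq with atPath u
        ... | inj₁ isA = A≢C (trans (sym isA) (trans eq (atIndependent c)))
        ... | inj₂ isB = B≢C (trans (sym isB) (trans eq (atIndependent c)))

-- Block designs

*+-injective : ∀ d {k k′ i i′} → i < d → i′ < d → k * d + i ≡ k′ * d + i′ → k ≡ k′ × i ≡ i′
*+-injective d {zero}  {zero}          _   _    eq = refl , eq
*+-injective d {zero}  {suc k′} {i} {i′} i<d _  eq =
  ⊥-elim (<⇒≱ i<d (≤-trans (m≤m+n d (k′ * d + i′)) (≤-reflexive (trans (sym (+-assoc d (k′ * d) i′)) (sym eq)))))
*+-injective d {suc k} {zero}  {i} {i′} _  i′<d eq =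
  ⊥-elim (<⇒≱ i′<d (≤-trans (m≤m+n d (k * d + i)) (≤-reflexive (trans (sym (+-assoc d (k * d) i)) eq))))
*+-injective d {suc k} {suc k′} {i} {i′} i<d i′<d eq
  with *+-injective d {k} {k′} i<d i′<d (+-cancelˡ-≡ d _ _ (trans (sym (+-assoc d (k * d) i)) (trans eq (+-assoc d (k′ * d) i′))))
... | refl , i≡i′ = refl , i≡i′

quotient-remainder : ∀ d k i .{{_ : NonZero d}} → i < d → (k * d + i) / d ≡ k × (k * d + i) % d ≡ i
quotient-remainder d k i i<d with *+-injective d i<d (m%n<n (k * d + i) d)
  (trans (m≡m%n+[m/n]*n (k * d + i) d) (+-comm _ ((k * d + i) / d * d)))
... | k≡ , i≡ = sym k≡ , sym i≡

*+-mono-< : ∀ {k r j s} → k < r → j < s → k * s + j < r * s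
*+-mono-< {k} {suc r} {j} {s} (s≤s k≤r) j<s =
  ≤-trans (+-monoʳ-< (k * s) j<s) (≤-trans (≤-reflexive (+-comm (k * s) s)) (+-monoʳ-≤ s (*-monoˡ-≤ s k≤r)))

applyUpTo-cong : ∀ {A : Set} m {f g : ℕ → A} → (∀ i → i < m → f i ≡ g i) → applyUpTo f m ≡ applyUpTo g m
applyUpTo-cong zero    f≗g = refl
applyUpTo-cong (suc m) f≗g = cong₂ _∷_ (f≗g 0 (s≤s z≤n)) (applyUpTo-cong m (λ i i<m → f≗g (suc i) (s≤s i<m)))

applyUpTo-++ : ∀ {A : Set} (f : ℕ → A) m m′ → applyUpTo f (m + m′) ≡ applyUpTo f m ++ applyUpTo (f ∘ (m +_)) m′
applyUpTo-++ f zero    m′ = refl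
applyUpTo-++ f (suc m) m′ = cong (f 0 ∷_) (applyUpTo-++ (f ∘ suc) m m′)

range : ℕ → ℕ → List ℕ
range b = applyUpTo (b +_)

range-++ : ∀ b m m′ → range b (m + m′) ≡ range b m ++ range (b + m) m′
range-++ b m m′ = trans (applyUpTo-++ (b +_) m m′) (cong (range b m ++_) (applyUpTo-cong m′ (λ i _ → sym (+-assoc b m i))))

concat-ranges : ∀ a b w → concat (applyUpTo (λ t → range (b + t * w) w) a) ≡ range b (a * w)
concat-ranges zero    b w = refl
concat-ranges (suc a) b w = begin
  range (b + 0) w ++ concat (applyUpTo (λ t → range (b + suc t * w) w) a)
    ≡⟨ cong₂ _++_ (cong (λ x → range x w) (+-identityʳ b))
                  (cong concat (applyUpTo-cong a (λ t _ → cong (λ x → range x w) (sym (+-assoc b w (t * w)))))) ⟩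
  range b w ++ concat (applyUpTo (λ t → range (b + w + t * w) w) a)
    ≡⟨ cong (range b w ++_) (concat-ranges a (b + w) w) ⟩
  range b w ++ range (b + w) (a * w)
    ≡⟨ sym (range-++ b w (a * w)) ⟩
  range b (suc a * w) ∎
  where open ≡-Reasoning

map-copiesLabels : (pos : ℕ → ℕ) (w : ℕ) → ∀ m ls b → (∀ k → k < m → map pos (ls k) ≡ range (b + k * w) w) →
  map pos (copiesLabels m ls) ≡ range b (m * w)
map-copiesLabels pos w zero    ls b copy = refl
map-copiesLabels pos w (suc m) ls b copy = begin
  map pos (ls 0 ++ copiesLabels m (ls ∘ suc))
    ≡⟨ map-++ pos (ls 0) _ ⟩
  map pos (ls 0) ++ map pos (copiesLabels m (ls ∘ suc))
    ≡⟨ cong₂ _++_ (trans (copy 0 (s≤s z≤n)) (cong (λ x → range x w) (+-identityʳ b)))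
                  (map-copiesLabels pos w m (ls ∘ suc) (b + w)
                     (λ k k<m → trans (copy (suc k) (s≤s k<m)) (cong (λ x → range x w) (sym (+-assoc b w (k * w)))))) ⟩
  range b w ++ range (b + w) (m * w)
    ≡⟨ sym (range-++ b w (m * w)) ⟩
  range b (suc m * w) ∎
  where open ≡-Reasoning

all-copiesLabels : ∀ {P : ℕ → Set} m ls → (∀ k → k < m → All P (ls k)) → All P (copiesLabels m ls)
all-copiesLabels zero    ls copy = []
all-copiesLabels (suc m) ls copy = ++⁺ (copy 0 (s≤s z≤n)) (all-copiesLabels m (ls ∘ suc) (λ k k<m → copy (suc k) (s≤s k<m)))

flip : ℕ → ℕ
flip zero    = 1
flip (suc _) = 0

flip-flip : ∀ {e} → e < 2 → flip (flip e) ≡ e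
flip-flip {zero}          _ = refl
flip-flip {suc zero}      _ = refl
flip-flip {suc (suc _)}   (s≤s (s≤s ()))

flip<2 : ∀ e → flip e < 2
flip<2 zero    = s≤s (s≤s z≤n)
flip<2 (suc _) = s≤s z≤n

data Slot : Set where
  matchSlot : (h e : ℕ) → Slot
  joinSlot  : (h e sd c : ℕ) → Slot

-- Block h < r s is formed by two matching edges e ∈ {0, 1} of one copy of (2s)P₂ ∨ O_{2n} and their
-- 8n edges to O_{2n}; joinLabel h e sd c labels the edge from end sd (x for 0, y for 1) of edge e to
-- the c-th vertex of O_{2n}.
record BlockDesign (n r s : ℕ) : Set where
  field
    matchLabel : ℕ → ℕ → ℕ
    joinLabel  : ℕ → ℕ → ℕ → ℕ → ℕ
    A B κ      : ℕ
    x-sum : ∀ h e → h < r * s → e < 2 → matchLabel h e + sumRange (joinLabel h e 0) (2 * n) ≡ A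
    y-sum : ∀ h e → h < r * s → e < 2 → matchLabel h e + sumRange (joinLabel h e 1) (2 * n) ≡ B
    z-sum : ∀ h c → h < r * s → c < 2 * n →
            (joinLabel h 0 0 c + joinLabel h 0 1 c) + (joinLabel h 1 0 c + joinLabel h 1 1 c) ≡ κ
    A≢B  : A ≢ B
    A≢sκ : A ≢ s * κ
    B≢sκ : B ≢ s * κ
    decode : ℕ → Slot
    decode-matchLabel : ∀ h e → h < r * s → e < 2 → decode (matchLabel h e) ≡ matchSlot h e
    decode-joinLabel  : ∀ h e sd c → h < r * s → e < 2 → sd < 2 → c < 2 * n →
                        decode (joinLabel h e sd c) ≡ joinSlot h e sd c
    matchLabel-range : ∀ h e → h < r * s → e < 2 →
                       1 ≤ matchLabel h e × matchLabel h e ≤ 2 * (r * s * (4 * n + 1))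
    joinLabel-range  : ∀ h e sd c → h < r * s → e < 2 → sd < 2 → c < 2 * n →
                       1 ≤ joinLabel h e sd c × joinLabel h e sd c ≤ 2 * (r * s * (4 * n + 1))

module Assemble {n r s : ℕ} .{{_ : NonZero s}} (D : BlockDesign n r s) where

  open BlockDesign D
  open JoinGraph n s

  copyMatch : ℕ → ℕ → ℕ
  copyMatch k i = matchLabel (k * s + ⌊ i /2⌋) (parity i)

  copyJoin : ℕ → ℕ → ℕ → ℕ → ℕ
  copyJoin k i = joinLabel (k * s + ⌊ i /2⌋) (parity i)

  labels : List ℕ
  labels = copiesLabels r (λ k → copyLabels (copyMatch k) (copyJoin k))

  private
    block< : ∀ {k i} → k < r → i < 2 * s → k * s + ⌊ i /2⌋ < r * s
    block< {i = i} k<r i<2s = *+-mono-< k<r (⌊n/2⌋<m i s i<2s)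

  qH : ℕ
  qH = 2 * s + V G * (2 * n)

  -- the index in E (copies r H) of the edge with a given slot
  position : Slot → ℕ
  position (matchSlot h e)     = h / s * qH + (h % s * 2 + e)
  position (joinSlot h e sd c) = h / s * qH + 2 * s + ((h % s * 2 + e) * 2 + sd) * (2 * n) + c

  private
    unblock : ∀ k i → i < 2 * s → (k * s + ⌊ i /2⌋) / s ≡ k × (k * s + ⌊ i /2⌋) % s * 2 + parity i ≡ i
    unblock k i i<2s with quotient-remainder s k ⌊ i /2⌋ (⌊n/2⌋<m i s i<2s)
    ... | q≡k , r≡ = q≡k , trans (cong (λ x → x * 2 + parity i) r≡) (⌊n/2⌋*2+parity≡n i)

  position-copyMatch : ∀ k i → k < r → i < 2 * s → position (decode (copyMatch k i)) ≡ k * qH + i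
  position-copyMatch k i k<r i<2s rewrite decode-matchLabel _ _ (block< k<r i<2s) (parity<2 i)
    with unblock k i i<2s
  ... | q≡k , r≡ = cong₂ (λ x y → x * qH + y) q≡k r≡

  position-copyJoin : ∀ k → k < r → (u : Fin (V G)) (c : Fin (2 * n)) →
    position (decode (atVertex (copyJoin k) u c)) ≡ k * qH + 2 * s + toℕ u * (2 * n) + toℕ c
  position-copyJoin k k<r u c
    rewrite decode-joinLabel _ _ _ _ (block< k<r (component< u)) (parity<2 ⌊ toℕ u /2⌋) (parity<2 (toℕ u)) (toℕ<n c)
    with unblock k ⌊ toℕ u /2⌋ (component< u)
  ... | q≡k , r≡ = trans (cong₂ (λ x y → x * qH + 2 * s + (y * 2 + parity (toℕ u)) * (2 * n) + toℕ c) q≡k r≡)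
                         (cong (λ t → k * qH + 2 * s + t * (2 * n) + toℕ c) (⌊n/2⌋*2+parity≡n (toℕ u)))

  labelPosition : ℕ → ℕ
  labelPosition = position ∘ decode

  map-labelPosition-copy : ∀ k → k < r → map labelPosition (copyLabels (copyMatch k) (copyJoin k)) ≡ range (k * qH) qH
  map-labelPosition-copy k k<r = begin
    map labelPosition (applyUpTo (copyMatch k) (2 * s) ++ joinLabels (atVertex (copyJoin k)))
      ≡⟨ map-++ labelPosition (applyUpTo (copyMatch k) (2 * s)) _ ⟩
    map labelPosition (applyUpTo (copyMatch k) (2 * s)) ++ map labelPosition (joinLabels (atVertex (copyJoin k)))
      ≡⟨ cong₂ _++_ matching joining ⟩
    range (k * qH) (2 * s) ++ range (k * qH + 2 * s) (V G * (2 * n))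
      ≡⟨ sym (range-++ (k * qH) (2 * s) (V G * (2 * n))) ⟩
    range (k * qH) qH ∎
    where
    open ≡-Reasoning
    matching : map labelPosition (applyUpTo (copyMatch k) (2 * s)) ≡ range (k * qH) (2 * s)
    matching = trans (map-applyUpTo (copyMatch k) labelPosition (2 * s))
                     (applyUpTo-cong (2 * s) (λ i → position-copyMatch k i k<r))
    row : ∀ u → map labelPosition (map (atVertex (copyJoin k) u) (allFin (2 * n))) ≡ range (k * qH + 2 * s + toℕ u * (2 * n)) (2 * n)
    row u = begin
      map labelPosition (map (atVertex (copyJoin k) u) (allFin (2 * n)))
        ≡⟨ sym (map-∘ (allFin (2 * n))) ⟩
      map (labelPosition ∘ atVertex (copyJoin k) u) (allFin (2 * n))
        ≡⟨ map-cong (position-copyJoin k k<r u) (allFin (2 * n)) ⟩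
      map ((k * qH + 2 * s + toℕ u * (2 * n) +_) ∘ toℕ) (allFin (2 * n))
        ≡⟨ map-allFin (2 * n) _ ⟩
      range (k * qH + 2 * s + toℕ u * (2 * n)) (2 * n) ∎
    joining : map labelPosition (joinLabels (atVertex (copyJoin k))) ≡ range (k * qH + 2 * s) (V G * (2 * n))
    joining = begin
      map labelPosition (joinLabels (atVertex (copyJoin k)))
        ≡⟨ map-concatMap labelPosition _ (allFin (V G)) ⟩
      concatMap (λ u → map labelPosition (map (atVertex (copyJoin k) u) (allFin (2 * n)))) (allFin (V G))
        ≡⟨ cong concat (trans (map-cong row (allFin (V G))) (map-allFin (V G) (λ t → range (k * qH + 2 * s + t * (2 * n)) (2 * n)))) ⟩
      concat (applyUpTo (λ t → range (k * qH + 2 * s + t * (2 * n)) (2 * n)) (V G))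
        ≡⟨ concat-ranges (V G) (k * qH + 2 * s) (2 * n) ⟩
      range (k * qH + 2 * s) (V G * (2 * n)) ∎

  labels-unique : Unique labels
  labels-unique = Unique.map⁻ (subst Unique (sym (map-copiesLabels labelPosition qH r _ 0 map-labelPosition-copy)) (Unique.upTo⁺ (r * qH)))

  edgeCount : q (copies r H) ≡ 2 * (r * s * (4 * n + 1))
  edgeCount = begin
    q (copies r H)                                ≡⟨ sym (length-copiesLabels H r _ (λ k → length-copyLabels (copyMatch k) (copyJoin k))) ⟩
    length labels                                 ≡⟨ sym (length-map labelPosition labels) ⟩
    length (map labelPosition labels)                     ≡⟨ cong length (map-copiesLabels labelPosition qH r _ 0 map-labelPosition-copy) ⟩
    length (range 0 (r * qH))                     ≡⟨ length-applyUpTo _ (r * qH) ⟩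
    r * (2 * s + V G * (2 * n))                   ≡⟨ cong (λ v → r * (2 * s + v * (2 * n))) (V-copies-P₂ (2 * s)) ⟩
    r * (2 * s + 2 * (2 * s) * (2 * n))           ≡⟨ edges r s n ⟩
    2 * (r * s * (4 * n + 1)) ∎
    where
    open ≡-Reasoning
    edges : ∀ r s n → r * (2 * s + 2 * (2 * s) * (2 * n)) ≡ 2 * (r * s * (4 * n + 1))
    edges r s n = solve (r List.∷ s List.∷ n List.∷ List.[])

  labels-range : All (λ l → 1 ≤ l × l ≤ q (copies r H)) labels
  labels-range = subst (λ N → All (λ l → 1 ≤ l × l ≤ N) labels) (sym edgeCount)
    (all-copiesLabels r _ λ k k<r → ++⁺
      (applyUpTo⁺₁ (copyMatch k) (2 * s) (λ {i} i<2s → matchLabel-range _ _ (block< k<r i<2s) (parity<2 i)))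
      (concat⁺ (map⁺ (All.universal (λ u → map⁺ (All.universal (λ c →
         joinLabel-range _ _ _ _ (block< k<r (component< u)) (parity<2 ⌊ toℕ u /2⌋) (parity<2 (toℕ u)) (toℕ<n c)) (allFin (2 * n))))
       (allFin (V G))))))

  copy-x-sum : ∀ k → k < r → ∀ i → i < 2 * s → copyMatch k i + sumRange (copyJoin k i 0) (2 * n) ≡ A
  copy-x-sum k k<r i i<2s = x-sum _ _ (block< k<r i<2s) (parity<2 i)

  copy-y-sum : ∀ k → k < r → ∀ i → i < 2 * s → copyMatch k i + sumRange (copyJoin k i 1) (2 * n) ≡ B
  copy-y-sum k k<r i i<2s = y-sum _ _ (block< k<r i<2s) (parity<2 i)

  copy-z-sum : ∀ k → k < r → ∀ c → c < 2 * n → sumRange (λ i → copyJoin k i 0 c + copyJoin k i 1 c) (2 * s) ≡ s * κ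
  copy-z-sum k k<r c c<2n =
    trans (sumRange-halves s (λ j e → joinLabel (k * s + j) e 0 c + joinLabel (k * s + j) e 1 c))
          (sumRange-const s κ (λ j j<s → z-sum (k * s + j) c (*+-mono-< k<r j<s) c<2n))

blockDesign⇒χla≡3 : ∀ {n r s} → BlockDesign (suc n) (suc r) (suc s) →
  ChiLaEq (copies (suc r) (copies (2 * suc s) P₂ ∨ᵍ O (2 * suc n))) 3
blockDesign⇒χla≡3 {n} {r} {s} D = (f , antimagic , ≤-antisym (numColors≤3 Gr f values) (atLeast3 f antimagic)) , atLeast3
  where
  open BlockDesign D
  open JoinGraph (suc n) (suc s)
  open Assemble D

  Gr : Graph
  Gr = copies (suc r) H

  copyLabelsOf : ℕ → List ℕ
  copyLabelsOf k = copyLabels (copyMatch k) (copyJoin k)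

  copyLengths : ∀ k → length (copyLabelsOf k) ≡ q H
  copyLengths k = length-copyLabels (copyMatch k) (copyJoin k)

  labeling : Σ (Labeling Gr) λ f → tabulate (label Gr f) ≡ labels
  labeling = labelingFromList Gr labels (length-copiesLabels H (suc r) copyLabelsOf copyLengths) labels-unique labels-range

  f : Labeling Gr
  f = proj₁ labeling

  vsum≡ : ∀ u → vsum Gr f u ≡ incidentSum (E Gr) labels u
  vsum≡ u = trans (vsum≡incidentSum Gr f u) (cong (λ ls → incidentSum (E Gr) ls u) (proj₂ labeling))

  values : ∀ u → vsum Gr f u ∈ A ∷ B ∷ suc s * κ ∷ []
  values u = subst (_∈ A ∷ B ∷ suc s * κ ∷ []) (sym (vsum≡ u)) (copies-values H (_∈ A ∷ B ∷ suc s * κ ∷ []) (suc r) copyLabelsOf copyLengths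
    (λ k k<r → copy-values (copyMatch k) (copyJoin k) (copy-x-sum k k<r) (copy-y-sum k k<r) (copy-z-sum k k<r)) u)

  antimagic : IsLocalAntimagic Gr f
  antimagic = separating⇒localAntimagic Gr f (separating-cong (sym ∘ vsum≡) (copies-separating H (suc r) copyLabelsOf copyLengths
    (λ k k<r → copy-separating (copyMatch k) (copyJoin k) (copy-x-sum k k<r) (copy-y-sum k k<r) (copy-z-sum k k<r) A≢B A≢sκ B≢sκ)))

  atLeast3 : (g : Labeling Gr) → IsLocalAntimagic Gr g → 3 ≤ numColors Gr g
  atLeast3 = triangle⇒3≤numColors Gr (copies-triangle H r (∨O-triangle G (2 * suc n) (here refl) fzero))

-- A block design for n = 1

≢-by-gap : ∀ {x y} d → y ≡ x + suc d → x ≢ y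
≢-by-gap {x} d y≡ x≡y = m≢1+m+n x (trans x≡y (trans y≡ (+-suc x d)))

module DesignOne (r s : ℕ) where

  Q : ℕ
  Q = suc r * suc s

  mirror : ℕ → ℕ
  mirror h = Q ∸ suc h

  mirror-sum : ∀ {h} → h < Q → suc h + mirror h ≡ Q
  mirror-sum = m+[n∸m]≡n

  mirror< : ∀ {h} → h < Q → mirror h < Q
  mirror< {h} h<Q = subst (mirror h <_) (mirror-sum h<Q) (s≤s (m≤n+m (mirror h) h))

  mirror-mirror : ∀ {h} → h < Q → mirror (mirror h) ≡ h
  mirror-mirror {h} h<Q = trans (cong (_∸ suc (mirror h)) (sym total)) (m+n∸m≡n (suc (mirror h)) h)
    where
    total : suc (mirror h) + h ≡ Q
    total = trans (cong suc (+-comm (mirror h) h)) (mirror-sum h<Q)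

  -- The labels are the numbers 1 + 5β + ρ with β < 2Q and ρ < 5, i.e. 1, …, 10Q.
  cell : ℕ → ℕ → ℕ
  cell β ρ = suc (β * 5 + ρ)

  matchLabel : ℕ → ℕ → ℕ
  matchLabel h zero    = cell (mirror h * 2 + 1) 3
  matchLabel h (suc _) = cell (h * 2 + 0) 3

  blockOf : ℕ → ℕ → ℕ
  blockOf h zero    = h
  blockOf h (suc _) = mirror h

  residue : ℕ → ℕ → ℕ → ℕ
  residue zero    zero    zero    = 0
  residue zero    zero    (suc _) = 1
  residue zero    (suc _) zero    = 1
  residue zero    (suc _) (suc _) = 0
  residue (suc _) zero    zero    = 2
  residue (suc _) zero    (suc _) = 4
  residue (suc _) (suc _) zero    = 4
  residue (suc _) (suc _) (suc _) = 2

  joinLabel : ℕ → ℕ → ℕ → ℕ → ℕ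
  joinLabel h e sd c = cell (sd * Q + blockOf h e) (residue e sd c)

  A B κ : ℕ
  A = 10 * Q + 2
  B = 20 * Q + 2
  κ = 20 * Q + 1

  -- Each sum is a polynomial identity once Q is written as suc h + mirror h.
  x-sum : ∀ h e → h < Q → e < 2 → matchLabel h e + sumRange (joinLabel h e 0) 2 ≡ A
  x-sum h zero          h<Q _ = x₀ h (mirror h) Q (mirror-sum h<Q)
    where
    x₀ : ∀ h h̄ Q → suc h + h̄ ≡ Q →
      suc ((h̄ * 2 + 1) * 5 + 3) + (suc (h * 5 + 0) + (suc (h * 5 + 1) + 0)) ≡ 10 * Q + 2
    x₀ h h̄ _ refl = solve (h List.∷ h̄ List.∷ List.[])
  x-sum h (suc zero)    h<Q _ = x₁ h (mirror h) Q (mirror-sum h<Q)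
    where
    x₁ : ∀ h h̄ Q → suc h + h̄ ≡ Q →
      suc ((h * 2 + 0) * 5 + 3) + (suc (h̄ * 5 + 2) + (suc (h̄ * 5 + 4) + 0)) ≡ 10 * Q + 2
    x₁ h h̄ _ refl = solve (h List.∷ h̄ List.∷ List.[])
  x-sum h (suc (suc _)) _ (s≤s (s≤s ()))

  y-sum : ∀ h e → h < Q → e < 2 → matchLabel h e + sumRange (joinLabel h e 1) 2 ≡ B
  y-sum h zero          h<Q _ = y₀ h (mirror h) Q (mirror-sum h<Q)
    where
    y₀ : ∀ h h̄ Q → suc h + h̄ ≡ Q →
      suc ((h̄ * 2 + 1) * 5 + 3) + (suc ((1 * Q + h) * 5 + 1) + (suc ((1 * Q + h) * 5 + 0) + 0)) ≡ 20 * Q + 2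
    y₀ h h̄ _ refl = solve (h List.∷ h̄ List.∷ List.[])
  y-sum h (suc zero)    h<Q _ = y₁ h (mirror h) Q (mirror-sum h<Q)
    where
    y₁ : ∀ h h̄ Q → suc h + h̄ ≡ Q →
      suc ((h * 2 + 0) * 5 + 3) + (suc ((1 * Q + h̄) * 5 + 4) + (suc ((1 * Q + h̄) * 5 + 2) + 0)) ≡ 20 * Q + 2
    y₁ h h̄ _ refl = solve (h List.∷ h̄ List.∷ List.[])
  y-sum h (suc (suc _)) _ (s≤s (s≤s ()))

  z-sum : ∀ h c → h < Q → c < 2 →
    (joinLabel h 0 0 c + joinLabel h 0 1 c) + (joinLabel h 1 0 c + joinLabel h 1 1 c) ≡ κ
  z-sum h zero          h<Q _ = z₀ h (mirror h) Q (mirror-sum h<Q)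
    where
    z₀ : ∀ h h̄ Q → suc h + h̄ ≡ Q →
      (suc (h * 5 + 0) + suc ((1 * Q + h) * 5 + 1)) + (suc (h̄ * 5 + 2) + suc ((1 * Q + h̄) * 5 + 4)) ≡ 20 * Q + 1
    z₀ h h̄ _ refl = solve (h List.∷ h̄ List.∷ List.[])
  z-sum h (suc zero)    h<Q _ = z₁ h (mirror h) Q (mirror-sum h<Q)
    where
    z₁ : ∀ h h̄ Q → suc h + h̄ ≡ Q →
      (suc (h * 5 + 1) + suc ((1 * Q + h) * 5 + 0)) + (suc (h̄ * 5 + 4) + suc ((1 * Q + h̄) * 5 + 2)) ≡ 20 * Q + 1
    z₁ h h̄ _ refl = solve (h List.∷ h̄ List.∷ List.[])
  z-sum h (suc (suc _)) _ (s≤s (s≤s ()))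

  private
    q₀ : ℕ
    q₀ = s + r * suc s

  A≢B : A ≢ B
  A≢B = ≢-by-gap (9 + 10 * q₀) (gap q₀)
    where
    gap : ∀ q → 20 * suc q + 2 ≡ (10 * suc q + 2) + suc (9 + 10 * q)
    gap q = solve (q List.∷ List.[])

  A≢sκ : A ≢ suc s * κ
  A≢sκ = ≢-by-gap (8 + 10 * q₀ + s * κ) (gap q₀ s)
    where
    gap : ∀ q s → suc s * (20 * suc q + 1) ≡ (10 * suc q + 2) + suc (8 + 10 * q + s * (20 * suc q + 1))
    gap q s = solve (q List.∷ s List.∷ List.[])

  B≢sκ : B ≢ suc s * κ
  B≢sκ = gap s q₀
    where
    gap : ∀ s q → 20 * suc q + 2 ≢ suc s * (20 * suc q + 1)
    gap zero    q eq = ≢-by-gap 0 one (sym eq)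
      where
      one : 20 * suc q + 2 ≡ 1 * (20 * suc q + 1) + 1
      one = solve (q List.∷ List.[])
    gap (suc s) q = ≢-by-gap (19 + 20 * q + s * (20 * suc q + 1)) two
      where
      two : suc (suc s) * (20 * suc q + 1) ≡ (20 * suc q + 2) + suc (19 + 20 * q + s * (20 * suc q + 1))
      two = solve (q List.∷ s List.∷ List.[])

  -- Inverts the tables above: a cell is read by its residue ρ, its sheet t = β / Q (the end sd of a
  -- join edge), its block g = β % Q, and for matching labels the parity and half of β.
  decodeMatch : ℕ → ℕ → Slot
  decodeMatch zero    k = matchSlot k 1
  decodeMatch (suc _) k = matchSlot (mirror k) 0

  decodeAt : (t g p k ρ : ℕ) → Slot
  decodeAt t g p k 0 = joinSlot g 0 t t
  decodeAt t g p k 1 = joinSlot g 0 t (flip t)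
  decodeAt t g p k 2 = joinSlot (mirror g) 1 t t
  decodeAt t g p k 3 = decodeMatch p k
  decodeAt t g p k 4 = joinSlot (mirror g) 1 t (flip t)
  decodeAt t g p k _ = matchSlot 0 0

  decode : ℕ → Slot
  decode ℓ = decodeAt (β / Q) (β % Q) (parity β) ⌊ β /2⌋ (pred ℓ % 5)
    where
    β = pred ℓ / 5

  decode-cell : ∀ β ρ → ρ < 5 → decode (cell β ρ) ≡ decodeAt (β / Q) (β % Q) (parity β) ⌊ β /2⌋ ρ
  decode-cell β ρ ρ<5 with quotient-remainder 5 β ρ ρ<5
  ... | q≡β , r≡ρ rewrite q≡β | r≡ρ = refl

  decode-matchLabel : ∀ h e → h < Q → e < 2 → decode (matchLabel h e) ≡ matchSlot h e
  decode-matchLabel h zero h<Q _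
    rewrite decode-cell (mirror h * 2 + 1) 3 (s≤s (s≤s (s≤s (s≤s z≤n))))
          | proj₁ (⌊k*2+e/2⌋ (mirror h) 1 (s≤s (s≤s z≤n))) | proj₂ (⌊k*2+e/2⌋ (mirror h) 1 (s≤s (s≤s z≤n)))
          | mirror-mirror h<Q = refl
  decode-matchLabel h (suc zero) h<Q _
    rewrite decode-cell (h * 2 + 0) 3 (s≤s (s≤s (s≤s (s≤s z≤n))))
          | proj₁ (⌊k*2+e/2⌋ h 0 (s≤s z≤n)) | proj₂ (⌊k*2+e/2⌋ h 0 (s≤s z≤n)) = refl
  decode-matchLabel h (suc (suc _)) _ (s≤s (s≤s ()))

  residue<5 : ∀ e sd c → residue e sd c < 5
  residue<5 zero    zero    zero    = s≤s z≤n
  residue<5 zero    zero    (suc _) = s≤s (s≤s z≤n)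
  residue<5 zero    (suc _) zero    = s≤s (s≤s z≤n)
  residue<5 zero    (suc _) (suc _) = s≤s z≤n
  residue<5 (suc _) zero    zero    = s≤s (s≤s (s≤s z≤n))
  residue<5 (suc _) zero    (suc _) = ≤-refl
  residue<5 (suc _) (suc _) zero    = ≤-refl
  residue<5 (suc _) (suc _) (suc _) = s≤s (s≤s (s≤s z≤n))

  blockOf< : ∀ h e → h < Q → blockOf h e < Q
  blockOf< h zero    h<Q = h<Q
  blockOf< h (suc _) h<Q = mirror< h<Q

  decode-joinLabel : ∀ h e sd c → h < Q → e < 2 → sd < 2 → c < 2 → decode (joinLabel h e sd c) ≡ joinSlot h e sd c
  decode-joinLabel h e sd c h<Q e<2 sd<2 c<2
    rewrite decode-cell (sd * Q + blockOf h e) (residue e sd c) (residue<5 e sd c)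
          | proj₁ (quotient-remainder Q sd (blockOf h e) (blockOf< h e h<Q))
          | proj₂ (quotient-remainder Q sd (blockOf h e) (blockOf< h e h<Q)) = byCases e sd c e<2 sd<2 c<2
    where
    byCases : ∀ e sd c → e < 2 → sd < 2 → c < 2 →
      decodeAt sd (blockOf h e) (parity (sd * Q + blockOf h e)) ⌊ sd * Q + blockOf h e /2⌋ (residue e sd c) ≡ joinSlot h e sd c
    byCases 0 0 0 _ _ _ = refl
    byCases 0 0 1 _ _ _ = refl
    byCases 0 1 0 _ _ _ = refl
    byCases 0 1 1 _ _ _ = refl
    byCases 1 0 0 _ _ _ rewrite mirror-mirror h<Q = refl
    byCases 1 0 1 _ _ _ rewrite mirror-mirror h<Q = refl
    byCases 1 1 0 _ _ _ rewrite mirror-mirror h<Q = refl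
    byCases 1 1 1 _ _ _ rewrite mirror-mirror h<Q = refl
    byCases (suc (suc _)) _ _ (s≤s (s≤s ())) _ _
    byCases _ (suc (suc _)) _ _ (s≤s (s≤s ())) _
    byCases _ _ (suc (suc _)) _ _ (s≤s (s≤s ()))

  cell-range : ∀ β ρ → β < 2 * Q → ρ < 5 → 1 ≤ cell β ρ × cell β ρ ≤ 2 * (Q * 5)
  cell-range β ρ β<2Q ρ<5 = s≤s z≤n , (begin
    suc (β * 5 + ρ)   ≡⟨ sym (+-suc (β * 5) ρ) ⟩
    β * 5 + suc ρ     ≤⟨ +-monoʳ-≤ (β * 5) ρ<5 ⟩
    β * 5 + 5         ≡⟨ +-comm (β * 5) 5 ⟩
    suc β * 5         ≤⟨ *-monoˡ-≤ 5 β<2Q ⟩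
    2 * Q * 5         ≡⟨ *-assoc 2 Q 5 ⟩
    2 * (Q * 5)       ∎)
    where open ≤-Reasoning

  private
    double< : ∀ {k} e → k < Q → e < 2 → k * 2 + e < 2 * Q
    double< {k} e k<Q e<2 = subst (k * 2 + e <_) (*-comm Q 2) (*+-mono-< k<Q e<2)

  matchLabel-range : ∀ h e → h < Q → e < 2 → 1 ≤ matchLabel h e × matchLabel h e ≤ 2 * (Q * 5)
  matchLabel-range h zero          h<Q _ = cell-range _ 3 (double< 1 (mirror< h<Q) (s≤s (s≤s z≤n))) (s≤s (s≤s (s≤s (s≤s z≤n))))
  matchLabel-range h (suc zero)    h<Q _ = cell-range _ 3 (double< 0 h<Q (s≤s z≤n)) (s≤s (s≤s (s≤s (s≤s z≤n))))
  matchLabel-range h (suc (suc _)) _ (s≤s (s≤s ()))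

  joinLabel-range : ∀ h e sd c → h < Q → e < 2 → sd < 2 → c < 2 → 1 ≤ joinLabel h e sd c × joinLabel h e sd c ≤ 2 * (Q * 5)
  joinLabel-range h e sd c h<Q _ sd<2 _ = cell-range _ _ (*+-mono-< sd<2 (blockOf< h e h<Q)) (residue<5 e sd c)

design₁ : ∀ r s → BlockDesign 1 (suc r) (suc s)
design₁ r s = record
  { matchLabel = matchLabel ; joinLabel = joinLabel ; A = A ; B = B ; κ = κ
  ; x-sum = x-sum ; y-sum = y-sum ; z-sum = z-sum
  ; A≢B = A≢B ; A≢sκ = A≢sκ ; B≢sκ = B≢sκ
  ; decode = decode ; decode-matchLabel = decode-matchLabel ; decode-joinLabel = decode-joinLabel
  ; matchLabel-range = matchLabel-range ; joinLabel-range = joinLabel-range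
  }
  where open DesignOne r s

-- A block design for n ≥ 2

-- μ stands for the two matching edges of a block; base e c (c < 4) and ext t e b (c = 4 + 2t + b)
-- for the edge from the first end of matching edge e to the c-th vertex of O_{2n}.
data Role : Set where
  μ    : Role
  base : (e c : ℕ) → Role
  ext  : (t e b : ℕ) → Role

role : ℕ → ℕ → Role
role e 0                         = base e 0
role e 1                         = base e 1
role e 2                         = base e 2
role e 3                         = base e 3
role e (suc (suc (suc (suc c)))) = ext ⌊ c /2⌋ e (parity c)

coordinates : Role → ℕ × ℕ
coordinates μ           = 0 , 0
coordinates (base e c)  = e , c
coordinates (ext t e b) = e , 4 + (t * 2 + b)

coordinates-role : ∀ e c → coordinates (role e c) ≡ (e , c)
coordinates-role e 0                         = refl
coordinates-role e 1                         = refl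
coordinates-role e 2                         = refl
coordinates-role e 3                         = refl
coordinates-role e (suc (suc (suc (suc c)))) = cong (λ t → e , 4 + t) (⌊n/2⌋*2+parity≡n c)

-- whether the edge of a role carries the larger label of its complementary pair
isLarge : Role → Bool
isLarge (base 0 0)        = true
isLarge (base 0 1)        = true
isLarge (base 1 1)        = true
isLarge (base 1 2)        = true
isLarge (ext _ _ (suc _)) = true
isLarge _                 = false

ValidRole : ℕ → Role → Set
ValidRole m μ           = ⊤
ValidRole m (base e c)  = e < 2 × c < 4
ValidRole m (ext t e b) = t < m × e < 2 × b < 2

private
  regroup₀ : ∀ a b c d e X y z Y → (a + (b + (c + (d + (e + X))))) + ((y + z) + Y) ≡ a + (b + y) + (c + z) + d + e + (X + Y)
  regroup₀ a b c d e X y z Y = solve (a List.∷ b List.∷ c List.∷ d List.∷ e List.∷ X List.∷ y List.∷ z List.∷ Y List.∷ List.[])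

  x₀-identity : ∀ m Q h C →
    suc (m * 4 * Q + (1 * Q + h)) + C + C + suc (m * 4 * Q + (4 * Q + (0 * Q + h))) + suc (m * 4 * Q + (4 * Q + (2 * Q + h))) + m * C
    ≡ (suc (suc m) * C + (3 * Q * m + 9 * Q + 1)) + ((suc (m * 4 * Q + (2 * Q + (h * 2 + 0))) + suc (m * 4 * Q + (0 * Q + h))) + m * Q)
  x₀-identity m Q h C = solve (m List.∷ Q List.∷ h List.∷ C List.∷ List.[])

  regroup₁ : ∀ a b c d e X y z w Y → (a + (b + (c + (d + (e + X))))) + ((y + (z + w)) + Y) ≡ (a + y) + b + (c + z) + (d + w) + e + (X + Y)
  regroup₁ a b c d e X y z w Y = solve (a List.∷ b List.∷ c List.∷ d List.∷ e List.∷ X List.∷ y List.∷ z List.∷ w List.∷ Y List.∷ List.[])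

  x₁-identity : ∀ m Q h → let C = suc (2 * (Q * (4 * suc (suc m) + 1))) in
    C + suc (m * 4 * Q + (2 * Q + (h * 2 + 1))) + C + C + suc (m * 4 * Q + (4 * Q + (1 * Q + h))) + m * C
    ≡ (suc (suc m) * C + (3 * Q * m + 9 * Q + 1))
      + ((suc (m * 4 * Q + (1 * Q + h)) + (suc (m * 4 * Q + (4 * Q + (3 * Q + h))) + suc (m * 4 * Q + (4 * Q + (4 * Q + h))))) + m * Q)
  x₁-identity m Q h = solve (m List.∷ Q List.∷ h List.∷ List.[])

module DesignTwoPlus (m r s : ℕ) where

  n Q P C : ℕ
  n = suc (suc m)
  Q = suc r * suc s
  P = Q * (4 * n + 1)
  C = suc (2 * P)

  -- Every label is z or C ∸ z for some z ∈ [1, P]; small R h is the z used by role R in block h.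
  -- The roles ext t e b fill [1, 4mQ], the others the next 9Q values.
  o : ℕ
  o = m * 4 * Q

  small : Role → ℕ → ℕ
  small (ext t e b) h = suc ((t * 4 + (e * 2 + b)) * Q + h)
  small (base 0 1)  h = suc (o + (0 * Q + h))
  small μ           h = suc (o + (1 * Q + h))
  small (base 0 0)  h = suc (o + (2 * Q + (h * 2 + 0)))
  small (base 1 0)  h = suc (o + (2 * Q + (h * 2 + 1)))
  small (base 0 2)  h = suc (o + (4 * Q + (0 * Q + h)))
  small (base 1 3)  h = suc (o + (4 * Q + (1 * Q + h)))
  small (base 0 3)  h = suc (o + (4 * Q + (2 * Q + h)))
  small (base 1 1)  h = suc (o + (4 * Q + (3 * Q + h)))
  small (base 1 2)  h = suc (o + (4 * Q + (4 * Q + h)))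
  small _           h = 0

  complementIf : Bool → ℕ → ℕ
  complementIf false z = z
  complementIf true  z = C ∸ z

  matchLabel : ℕ → ℕ → ℕ
  matchLabel h zero    = complementIf false (small μ h)
  matchLabel h (suc _) = complementIf true  (small μ h)

  -- the second end of edge e is joined by the complement of the first end of edge flip e
  joinLabel : ℕ → ℕ → ℕ → ℕ → ℕ
  joinLabel h e zero    c = complementIf (isLarge (role e c)) (small (role e c) h)
  joinLabel h e (suc _) c = complementIf (not (isLarge (role (flip e) c))) (small (role (flip e) c) h)

  low : ℕ → ℕ → Role × ℕ
  low zero    h = base 0 1 , h
  low (suc _) h = μ , h

  mid : ℕ → ℕ → Role × ℕ
  mid h zero    = base 0 0 , h
  mid h (suc _) = base 1 0 , h

  high : ℕ → ℕ → Role × ℕ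
  high 0 h = base 0 2 , h
  high 1 h = base 1 3 , h
  high 2 h = base 0 3 , h
  high 3 h = base 1 1 , h
  high _ h = base 1 2 , h

  locate : ℕ → Role × ℕ
  locate x = if ⌊ x <? o ⌋ then locateExt x else locateBase (x ∸ o)
    where
    locateExt : ℕ → Role × ℕ
    locateExt x = ext (x / Q / 4) ⌊ x / Q % 4 /2⌋ (parity (x / Q % 4)) , x % Q
    locateBase : ℕ → Role × ℕ
    locateBase y =
      if ⌊ y <? 2 * Q ⌋ then low (y / Q) (y % Q)
      else if ⌊ y <? 4 * Q ⌋ then mid ⌊ y ∸ 2 * Q /2⌋ (parity (y ∸ 2 * Q))
      else high ((y ∸ 4 * Q) / Q) ((y ∸ 4 * Q) % Q)

  private
    4Q≡2Q+2Q : 4 * Q ≡ 2 * Q + 2 * Q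
    4Q≡2Q+2Q = *-distribʳ-+ Q 2 2

    9Q≡4Q+5Q : 9 * Q ≡ 4 * Q + 5 * Q
    9Q≡4Q+5Q = *-distribʳ-+ Q 4 5

    locate-base : ∀ y → locate (o + y) ≡
      (if ⌊ y <? 2 * Q ⌋ then low (y / Q) (y % Q)
       else if ⌊ y <? 4 * Q ⌋ then mid ⌊ y ∸ 2 * Q /2⌋ (parity (y ∸ 2 * Q))
       else high ((y ∸ 4 * Q) / Q) ((y ∸ 4 * Q) % Q))
    locate-base y rewrite ⌊⌋-false (o + y <? o) (λ p → <-irrefl refl (≤-trans p (m≤m+n o y))) | m+n∸m≡n o y = refl

    locate-low : ∀ g h → g < 2 → h < Q → locate (o + (g * Q + h)) ≡ low g h
    locate-low g h g<2 h<Q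
      rewrite locate-base (g * Q + h) | ⌊⌋-true (g * Q + h <? 2 * Q) (*+-mono-< g<2 h<Q)
            | proj₁ (quotient-remainder Q g h h<Q) | proj₂ (quotient-remainder Q g h h<Q) = refl

    locate-mid : ∀ h ε → ε < 2 → h < Q → locate (o + (2 * Q + (h * 2 + ε))) ≡ mid h ε
    locate-mid h ε ε<2 h<Q
      rewrite locate-base (2 * Q + (h * 2 + ε))
            | ⌊⌋-false (2 * Q + (h * 2 + ε) <? 2 * Q) (λ p → <-irrefl refl (≤-trans p (m≤m+n (2 * Q) _)))
            | ⌊⌋-true (2 * Q + (h * 2 + ε) <? 4 * Q)
                (subst (2 * Q + (h * 2 + ε) <_) (sym 4Q≡2Q+2Q)
                  (+-monoʳ-< (2 * Q) (subst (h * 2 + ε <_) (*-comm Q 2) (*+-mono-< h<Q ε<2))))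
            | m+n∸m≡n (2 * Q) (h * 2 + ε)
            | proj₁ (⌊k*2+e/2⌋ h ε ε<2) | proj₂ (⌊k*2+e/2⌋ h ε ε<2) = refl

    locate-high : ∀ g h → h < Q → locate (o + (4 * Q + (g * Q + h))) ≡ high g h
    locate-high g h h<Q
      rewrite locate-base (4 * Q + (g * Q + h))
            | ⌊⌋-false (4 * Q + (g * Q + h) <? 2 * Q)
                (λ p → <-irrefl refl (≤-trans p (≤-trans (subst (2 * Q ≤_) (sym 4Q≡2Q+2Q) (m≤m+n (2 * Q) (2 * Q))) (m≤m+n (4 * Q) _))))
            | ⌊⌋-false (4 * Q + (g * Q + h) <? 4 * Q) (λ p → <-irrefl refl (≤-trans p (m≤m+n (4 * Q) _)))
            | m+n∸m≡n (4 * Q) (g * Q + h)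
            | proj₁ (quotient-remainder Q g h h<Q) | proj₂ (quotient-remainder Q g h h<Q) = refl

    locate-ext : ∀ t e b h → t < m → e < 2 → b < 2 → h < Q → locate ((t * 4 + (e * 2 + b)) * Q + h) ≡ (ext t e b , h)
    locate-ext t e b h t<m e<2 b<2 h<Q
      rewrite ⌊⌋-true ((t * 4 + (e * 2 + b)) * Q + h <? o) (*+-mono-< (*+-mono-< t<m (*+-mono-< e<2 b<2)) h<Q)
            | proj₁ (quotient-remainder Q (t * 4 + (e * 2 + b)) h h<Q) | proj₂ (quotient-remainder Q (t * 4 + (e * 2 + b)) h h<Q)
            | proj₁ (quotient-remainder 4 t (e * 2 + b) (*+-mono-< e<2 b<2)) | proj₂ (quotient-remainder 4 t (e * 2 + b) (*+-mono-< e<2 b<2))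
            | proj₁ (⌊k*2+e/2⌋ e b b<2) | proj₂ (⌊k*2+e/2⌋ e b b<2) = refl

  locate-small : ∀ R h → ValidRole m R → h < Q → locate (pred (small R h)) ≡ (R , h)
  locate-small μ           h _ h<Q = locate-low 1 h (s≤s (s≤s z≤n)) h<Q
  locate-small (base 0 0)  h _ h<Q = locate-mid h 0 (s≤s z≤n) h<Q
  locate-small (base 1 0)  h _ h<Q = locate-mid h 1 (s≤s (s≤s z≤n)) h<Q
  locate-small (base 0 1)  h _ h<Q = locate-low 0 h (s≤s z≤n) h<Q
  locate-small (base 0 2)  h _ h<Q = locate-high 0 h h<Q
  locate-small (base 1 3)  h _ h<Q = locate-high 1 h h<Q
  locate-small (base 0 3)  h _ h<Q = locate-high 2 h h<Q
  locate-small (base 1 1)  h _ h<Q = locate-high 3 h h<Q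
  locate-small (base 1 2)  h _ h<Q = locate-high 4 h h<Q
  locate-small (base (suc (suc _)) _) h (s≤s (s≤s ()) , _) _
  locate-small (base 0 (suc (suc (suc (suc _))))) h (_ , s≤s (s≤s (s≤s (s≤s ())))) _
  locate-small (base 1 (suc (suc (suc (suc _))))) h (_ , s≤s (s≤s (s≤s (s≤s ())))) _
  locate-small (ext t e b) h (t<m , e<2 , b<2) h<Q = locate-ext t e b h t<m e<2 b<2 h<Q

  2n≡4+2m : 2 * n ≡ 4 + 2 * m
  2n≡4+2m = lemma m
    where
    lemma : ∀ m → 2 * suc (suc m) ≡ 4 + 2 * m
    lemma m = solve (m List.∷ List.[])

  valid-role : ∀ e c → e < 2 → c < 2 * n → ValidRole m (role e c)
  valid-role e 0 e<2 _ = e<2 , s≤s z≤n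
  valid-role e 1 e<2 _ = e<2 , s≤s (s≤s z≤n)
  valid-role e 2 e<2 _ = e<2 , s≤s (s≤s (s≤s z≤n))
  valid-role e 3 e<2 _ = e<2 , ≤-refl
  valid-role e (suc (suc (suc (suc c)))) e<2 c<2n =
    ⌊n/2⌋<m c m (≤-pred (≤-pred (≤-pred (≤-pred (subst (suc (suc (suc (suc c))) <_) 2n≡4+2m c<2n))))) , e<2 , parity<2 c

  private
    o+9Q≡P : o + 9 * Q ≡ P
    o+9Q≡P = lemma m Q
      where
      lemma : ∀ m Q → m * 4 * Q + 9 * Q ≡ Q * (4 * suc (suc m) + 1)
      lemma m Q = solve (m List.∷ Q List.∷ List.[])

    inBase : ∀ {y} → y < 9 * Q → suc (o + y) ≤ P
    inBase {y} y<9Q = subst (o + y <_) o+9Q≡P (+-monoʳ-< o y<9Q)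

    inMid : ∀ {h} ε → h < Q → ε < 2 → 2 * Q + (h * 2 + ε) < 9 * Q
    inMid {h} ε h<Q ε<2 = ≤-trans (+-monoʳ-< (2 * Q) (subst (h * 2 + ε <_) (*-comm Q 2) (*+-mono-< h<Q ε<2)))
                                  (subst (2 * Q + 2 * Q ≤_) (sym 9Q≡4Q+5Q) (subst (_≤ 4 * Q + 5 * Q) 4Q≡2Q+2Q (m≤m+n (4 * Q) (5 * Q))))

    inHigh : ∀ {g h} → g < 5 → h < Q → 4 * Q + (g * Q + h) < 9 * Q
    inHigh {g} {h} g<5 h<Q = subst (4 * Q + (g * Q + h) <_) (sym 9Q≡4Q+5Q) (+-monoʳ-< (4 * Q) (*+-mono-< g<5 h<Q))

  small-range : ∀ R h → ValidRole m R → h < Q → 1 ≤ small R h × small R h ≤ P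
  small-range μ           h _ h<Q = s≤s z≤n , inBase (*+-mono-< {k = 1} {r = 9} (s≤s (s≤s z≤n)) h<Q)
  small-range (base 0 1)  h _ h<Q = s≤s z≤n , inBase (*+-mono-< {k = 0} {r = 9} (s≤s z≤n) h<Q)
  small-range (base 0 0)  h _ h<Q = s≤s z≤n , inBase (inMid 0 h<Q (s≤s z≤n))
  small-range (base 1 0)  h _ h<Q = s≤s z≤n , inBase (inMid 1 h<Q (s≤s (s≤s z≤n)))
  small-range (base 0 2)  h _ h<Q = s≤s z≤n , inBase (inHigh {0} (s≤s z≤n) h<Q)
  small-range (base 1 3)  h _ h<Q = s≤s z≤n , inBase (inHigh {1} (s≤s (s≤s z≤n)) h<Q)
  small-range (base 0 3)  h _ h<Q = s≤s z≤n , inBase (inHigh {2} (s≤s (s≤s (s≤s z≤n))) h<Q)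
  small-range (base 1 1)  h _ h<Q = s≤s z≤n , inBase (inHigh {3} (s≤s (s≤s (s≤s (s≤s z≤n)))) h<Q)
  small-range (base 1 2)  h _ h<Q = s≤s z≤n , inBase (inHigh {4} ≤-refl h<Q)
  small-range (base (suc (suc _)) _) h (s≤s (s≤s ()) , _) _
  small-range (base 0 (suc (suc (suc (suc _))))) h (_ , s≤s (s≤s (s≤s (s≤s ())))) _
  small-range (base 1 (suc (suc (suc (suc _))))) h (_ , s≤s (s≤s (s≤s (s≤s ())))) _
  small-range (ext t e b) h (t<m , e<2 , b<2) h<Q =
    s≤s z≤n , ≤-trans (*+-mono-< (*+-mono-< t<m (*+-mono-< e<2 b<2)) h<Q) (subst (o ≤_) o+9Q≡P (m≤m+n o (9 * Q)))

  P<C∸ : ∀ {z} → 1 ≤ z → z ≤ P → P < C ∸ z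
  P<C∸ {suc z} _ z<P = begin-strict
    P                   ≡⟨ sym (+-identityʳ P) ⟩
    P + 0               <⟨ +-monoʳ-< P (m<n⇒0<n∸m z<P+0) ⟩
    P + (P + 0 ∸ z)     ≡⟨ sym (+-∸-assoc P (<⇒≤ z<P+0)) ⟩
    P + (P + 0) ∸ z     ∎
    where
    open ≤-Reasoning
    z<P+0 : z < P + 0
    z<P+0 = subst (z <_) (sym (+-identityʳ P)) z<P

  complementIf-range : ∀ σ {z} → 1 ≤ z × z ≤ P → 1 ≤ complementIf σ z × complementIf σ z ≤ 2 * P
  complementIf-range false (1≤z , z≤P) = 1≤z , ≤-trans z≤P (m≤m+n P (P + 0))
  complementIf-range true  (1≤z , z≤P) = ≤-trans (s≤s z≤n) (P<C∸ 1≤z z≤P) , C∸z≤2P 1≤z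
    where
    C∸z≤2P : ∀ {z} → 1 ≤ z → C ∸ z ≤ 2 * P
    C∸z≤2P {suc z} _ = m∸n≤m (2 * P) z

  -- A label of role R sits at the first end of its matching edge exactly when its size agrees with isLarge R.
  joinSlotOf : Bool → Role → ℕ → Slot
  joinSlotOf σ R h =
    if σ xor isLarge R then joinSlot h (flip (proj₁ (coordinates R))) 1 (proj₂ (coordinates R))
    else joinSlot h (proj₁ (coordinates R)) 0 (proj₂ (coordinates R))

  slotOf : Bool → Role → ℕ → Slot
  slotOf σ μ             h = matchSlot h (if σ then 1 else 0)
  slotOf σ R@(base _ _)  h = joinSlotOf σ R h
  slotOf σ R@(ext _ _ _) h = joinSlotOf σ R h

  slotOf-role : ∀ σ e c h → slotOf σ (role e c) h ≡ joinSlotOf σ (role e c) h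
  slotOf-role σ e 0                         h = refl
  slotOf-role σ e 1                         h = refl
  slotOf-role σ e 2                         h = refl
  slotOf-role σ e 3                         h = refl
  slotOf-role σ e (suc (suc (suc (suc c)))) h = refl

  decode : ℕ → Slot
  decode ℓ = if ⌊ ℓ ≤? P ⌋ then slotAt false ℓ else slotAt true (C ∸ ℓ)
    where
    slotAt : Bool → ℕ → Slot
    slotAt σ z = slotOf σ (proj₁ (locate (pred z))) (proj₂ (locate (pred z)))

  decode-label : ∀ σ R h → ValidRole m R → h < Q → decode (complementIf σ (small R h)) ≡ slotOf σ R h
  decode-label false R h valid h<Q
    rewrite ⌊⌋-true (small R h ≤? P) (proj₂ (small-range R h valid h<Q)) | locate-small R h valid h<Q = refl
  decode-label true  R h valid h<Q
    rewrite ⌊⌋-false (C ∸ small R h ≤? P) (λ p → <-irrefl refl (≤-trans (P<C∸ (proj₁ (small-range R h valid h<Q)) (proj₂ (small-range R h valid h<Q))) p))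
          | m∸[m∸n]≡n {C} {small R h} (≤-trans (proj₂ (small-range R h valid h<Q)) (≤-trans (m≤m+n P (P + 0)) (n≤1+n _)))
          | locate-small R h valid h<Q = refl

  decode-matchLabel : ∀ h e → h < Q → e < 2 → decode (matchLabel h e) ≡ matchSlot h e
  decode-matchLabel h zero          h<Q _ = decode-label false μ h _ h<Q
  decode-matchLabel h (suc zero)    h<Q _ = decode-label true μ h _ h<Q
  decode-matchLabel h (suc (suc _)) _ (s≤s (s≤s ()))

  private
    not-xor-self : ∀ b → not b xor b ≡ true
    not-xor-self true  = refl
    not-xor-self false = refl

  decode-joinLabel : ∀ h e sd c → h < Q → e < 2 → sd < 2 → c < 2 * n → decode (joinLabel h e sd c) ≡ joinSlot h e sd c
  decode-joinLabel h e zero c h<Q e<2 _ c<2n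
    rewrite decode-label (isLarge (role e c)) (role e c) h (valid-role e c e<2 c<2n) h<Q
          | slotOf-role (isLarge (role e c)) e c h | xor-same (isLarge (role e c)) | coordinates-role e c = refl
  decode-joinLabel h e (suc zero) c h<Q e<2 _ c<2n
    rewrite decode-label (not (isLarge (role (flip e) c))) (role (flip e) c) h (valid-role (flip e) c (flip<2 e) c<2n) h<Q
          | slotOf-role (not (isLarge (role (flip e) c))) (flip e) c h | not-xor-self (isLarge (role (flip e) c))
          | coordinates-role (flip e) c | flip-flip e<2 = refl
  decode-joinLabel h e (suc (suc _)) c _ _ (s≤s (s≤s ())) _

  K ρ A B κ : ℕ
  K = C ∸ Q
  ρ = 3 * Q * m + 9 * Q + 1
  A = n * C + ρ
  B = n * C + (C ∸ ρ)
  κ = C + C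

  small≤C : ∀ R h → ValidRole m R → h < Q → small R h ≤ C
  small≤C R h valid h<Q = ≤-trans (proj₂ (small-range R h valid h<Q)) (≤-trans (m≤m+n P (P + 0)) (n≤1+n _))

  complementIf-sum : ∀ σ z → z ≤ C → complementIf σ z + complementIf (not σ) z ≡ C
  complementIf-sum false z z≤C = m+[n∸m]≡n z≤C
  complementIf-sum true  z z≤C = m∸n+n≡m z≤C

  private
    ext-pair : ∀ h e t → h < Q → e < 2 → t < m →
      complementIf false (small (ext t e 0) h) + complementIf true (small (ext t e 1) h) ≡ K
    ext-pair h e t h<Q e<2 t<m = begin
      z + (C ∸ small (ext t e 1) h)   ≡⟨ cong (λ x → z + (C ∸ x)) (next-slice t e Q h) ⟩
      z + (C ∸ (z + Q))               ≡⟨ cong (λ x → z + (C ∸ x)) (+-comm z Q) ⟩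
      z + (C ∸ (Q + z))               ≡⟨ cong (z +_) (sym (∸-+-assoc C Q z)) ⟩
      z + (C ∸ Q ∸ z)                 ≡⟨ m+[n∸m]≡n (m+n≤o⇒m≤o∸n z z+Q≤C) ⟩
      K ∎
      where
      open ≡-Reasoning
      z = small (ext t e 0) h
      next-slice : ∀ t e Q h → suc ((t * 4 + (e * 2 + 1)) * Q + h) ≡ suc ((t * 4 + (e * 2 + 0)) * Q + h) + Q
      next-slice t e Q h = solve (t List.∷ e List.∷ Q List.∷ h List.∷ List.[])
      z+Q≤C : z + Q ≤ C
      z+Q≤C = subst (_≤ C) (next-slice t e Q h) (small≤C (ext t e 1) h (t<m , e<2 , s≤s (s≤s z≤n)) h<Q)

  ext-sum : ∀ h e → h < Q → e < 2 → sumRange (λ i → joinLabel h e 0 (4 + i)) (2 * m) ≡ m * K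
  ext-sum h e h<Q e<2 =
    trans (sumRange-halves m (λ t b → complementIf (isLarge (ext t e b)) (small (ext t e b) h)))
          (sumRange-const m K (λ t t<m → ext-pair h e t h<Q e<2 t<m))

  private
    first-four : ∀ h e → sumRange (joinLabel h e 0) (2 * n) ≡
      joinLabel h e 0 0 + (joinLabel h e 0 1 + (joinLabel h e 0 2 + (joinLabel h e 0 3 + sumRange (λ i → joinLabel h e 0 (4 + i)) (2 * m))))
    first-four h e = cong (sumRange (joinLabel h e 0)) 2n≡4+2m

    mK+mQ≡mC : m * K + m * Q ≡ m * C
    mK+mQ≡mC = trans (sym (*-distribˡ-+ m K Q)) (cong (m *_) (m∸n+n≡m (≤-trans (m≤m*n Q (4 * n + 1)) (≤-trans (m≤m+n P (P + 0)) (n≤1+n _)))))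

    large+small : ∀ R h → ValidRole m R → h < Q → (C ∸ small R h) + small R h ≡ C
    large+small R h valid h<Q = complementIf-sum true (small R h) (small≤C R h valid h<Q)

  -- x-sums: add the small values of the large labels to both sides, so that no subtraction remains.
  x-sum : ∀ h e → h < Q → e < 2 → matchLabel h e + sumRange (joinLabel h e 0) (2 * n) ≡ A
  x-sum h zero h<Q _ =
    trans (cong (matchLabel h 0 +_) (first-four h 0))
    (trans (cong (λ X → small μ h + ((C ∸ x₀) + ((C ∸ x₁) + (x₂ + (x₃ + X))))) (ext-sum h 0 h<Q (s≤s z≤n)))
    (+-cancelʳ-≡ ((x₀ + x₁) + m * Q) _ _
      (trans (regroup₀ (small μ h) (C ∸ x₀) (C ∸ x₁) x₂ x₃ (m * K) x₀ x₁ (m * Q))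
      (trans (cong₃ (large+small (base 0 0) h (s≤s z≤n , s≤s z≤n) h<Q) (large+small (base 0 1) h (s≤s z≤n , s≤s (s≤s z≤n)) h<Q) mK+mQ≡mC)
             (x₀-identity m Q h C)))))
    where
    x₀ x₁ x₂ x₃ : ℕ
    x₀ = small (base 0 0) h
    x₁ = small (base 0 1) h
    x₂ = small (base 0 2) h
    x₃ = small (base 0 3) h
    cong₃ : ∀ {b b′ c c′ X X′} → b ≡ b′ → c ≡ c′ → X ≡ X′ → small μ h + b + c + x₂ + x₃ + X ≡ small μ h + b′ + c′ + x₂ + x₃ + X′
    cong₃ refl refl refl = refl
  x-sum h (suc zero) h<Q _ =
    trans (cong (matchLabel h 1 +_) (first-four h 1))
    (trans (cong (λ X → (C ∸ small μ h) + (y₀ + ((C ∸ y₁) + ((C ∸ y₂) + (y₃ + X))))) (ext-sum h 1 h<Q (s≤s (s≤s z≤n))))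
    (+-cancelʳ-≡ ((small μ h + (y₁ + y₂)) + m * Q) _ _
      (trans (regroup₁ (C ∸ small μ h) y₀ (C ∸ y₁) (C ∸ y₂) y₃ (m * K) (small μ h) y₁ y₂ (m * Q))
      (trans (cong₄ (large+small μ h _ h<Q) (large+small (base 1 1) h (s≤s (s≤s z≤n) , s≤s (s≤s z≤n)) h<Q)
                    (large+small (base 1 2) h (s≤s (s≤s z≤n) , s≤s (s≤s (s≤s z≤n))) h<Q) mK+mQ≡mC)
             (x₁-identity m Q h)))))
    where
    y₀ y₁ y₂ y₃ : ℕ
    y₀ = small (base 1 0) h
    y₁ = small (base 1 1) h
    y₂ = small (base 1 2) h
    y₃ = small (base 1 3) h
    cong₄ : ∀ {a a′ b b′ c c′ X X′} → a ≡ a′ → b ≡ b′ → c ≡ c′ → X ≡ X′ → a + y₀ + b + c + y₃ + X ≡ a′ + y₀ + b′ + c′ + y₃ + X′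
    cong₄ refl refl refl refl = refl
  x-sum h (suc (suc _)) _ (s≤s (s≤s ()))

  private
    matching-complement : ∀ h e → h < Q → e < 2 → matchLabel h e + matchLabel h (flip e) ≡ C
    matching-complement h zero          h<Q _ = complementIf-sum false (small μ h) (small≤C μ h _ h<Q)
    matching-complement h (suc zero)    h<Q _ = complementIf-sum true  (small μ h) (small≤C μ h _ h<Q)
    matching-complement h (suc (suc _)) _ (s≤s (s≤s ()))

    join-complement : ∀ h e c → h < Q → e < 2 → c < 2 * n → joinLabel h e 1 c + joinLabel h (flip e) 0 c ≡ C
    join-complement h e c h<Q e<2 c<2n =
      trans (+-comm (complementIf (not σ) z) (complementIf σ z)) (complementIf-sum σ z (small≤C R h (valid-role (flip e) c (flip<2 e) c<2n) h<Q))
      where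
      R = role (flip e) c
      σ = isLarge R
      z = small R h

    ρ<C : ρ < C
    ρ<C = ≤-trans (m<m+n ρ (s≤s z≤n)) (≤-reflexive (sym (gap m (s + r * suc s))))
      where
      gap : ∀ m q → suc (2 * (suc q * (4 * suc (suc m) + 1))) ≡ (3 * suc q * m + 9 * suc q + 1) + suc (5 * suc q * m + 8 + 9 * q)
      gap m q = solve (m List.∷ q List.∷ List.[])

  -- Adding the x-sum of edge flip e pairs every label with its complement.
  y-sum : ∀ h e → h < Q → e < 2 → matchLabel h e + sumRange (joinLabel h e 1) (2 * n) ≡ B
  y-sum h e h<Q e<2 = +-cancelʳ-≡ A _ _ (trans y+A (sym B+A))
    where
    y+A : matchLabel h e + sumRange (joinLabel h e 1) (2 * n) + A ≡ C + (n * C + n * C)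
    y+A = begin
      matchLabel h e + sumRange (joinLabel h e 1) (2 * n) + A
        ≡⟨ cong (matchLabel h e + sumRange (joinLabel h e 1) (2 * n) +_) (sym (x-sum h (flip e) h<Q (flip<2 e))) ⟩
      matchLabel h e + sumRange (joinLabel h e 1) (2 * n) + (matchLabel h (flip e) + sumRange (joinLabel h (flip e) 0) (2 * n))
        ≡⟨ interchange (matchLabel h e) _ (matchLabel h (flip e)) _ ⟩
      matchLabel h e + matchLabel h (flip e) + (sumRange (joinLabel h e 1) (2 * n) + sumRange (joinLabel h (flip e) 0) (2 * n))
        ≡⟨ cong₂ _+_ (matching-complement h e h<Q e<2) (sumRange-+ (2 * n) (joinLabel h e 1) (joinLabel h (flip e) 0)) ⟩
      C + sumRange (λ c → joinLabel h e 1 c + joinLabel h (flip e) 0 c) (2 * n)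
        ≡⟨ cong (C +_) (sumRange-const (2 * n) C (λ c c<2n → join-complement h e c h<Q e<2 c<2n)) ⟩
      C + 2 * n * C
        ≡⟨ cong (C +_) (trans (*-assoc 2 n C) (cong (n * C +_) (+-identityʳ (n * C)))) ⟩
      C + (n * C + n * C) ∎
      where open ≡-Reasoning
    B+A : B + A ≡ C + (n * C + n * C)
    B+A = begin
      (n * C + (C ∸ ρ)) + (n * C + ρ)    ≡⟨ interchange (n * C) (C ∸ ρ) (n * C) ρ ⟩
      (n * C + n * C) + ((C ∸ ρ) + ρ)    ≡⟨ +-comm (n * C + n * C) _ ⟩
      ((C ∸ ρ) + ρ) + (n * C + n * C)    ≡⟨ cong (_+ (n * C + n * C)) (m∸n+n≡m (<⇒≤ ρ<C)) ⟩
      C + (n * C + n * C) ∎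
      where open ≡-Reasoning

  z-sum : ∀ h c → h < Q → c < 2 * n →
    (joinLabel h 0 0 c + joinLabel h 0 1 c) + (joinLabel h 1 0 c + joinLabel h 1 1 c) ≡ κ
  z-sum h c h<Q c<2n = begin
    (joinLabel h 0 0 c + joinLabel h 0 1 c) + (joinLabel h 1 0 c + joinLabel h 1 1 c)
      ≡⟨ cong ((joinLabel h 0 0 c + joinLabel h 0 1 c) +_) (+-comm (joinLabel h 1 0 c) _) ⟩
    (joinLabel h 0 0 c + joinLabel h 0 1 c) + (joinLabel h 1 1 c + joinLabel h 1 0 c)
      ≡⟨ interchange (joinLabel h 0 0 c) _ _ _ ⟩
    (joinLabel h 0 0 c + joinLabel h 1 1 c) + (joinLabel h 0 1 c + joinLabel h 1 0 c)
      ≡⟨ cong₂ _+_ (trans (+-comm (joinLabel h 0 0 c) _) (join-complement h 1 c h<Q (s≤s (s≤s z≤n)) c<2n))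
                   (join-complement h 0 c h<Q (s≤s z≤n) c<2n) ⟩
    C + C ∎
    where open ≡-Reasoning

  matchLabel-range : ∀ h e → h < Q → e < 2 → 1 ≤ matchLabel h e × matchLabel h e ≤ 2 * P
  matchLabel-range h zero          h<Q _ = complementIf-range false (small-range μ h _ h<Q)
  matchLabel-range h (suc zero)    h<Q _ = complementIf-range true  (small-range μ h _ h<Q)
  matchLabel-range h (suc (suc _)) _ (s≤s (s≤s ()))

  joinLabel-range : ∀ h e sd c → h < Q → e < 2 → sd < 2 → c < 2 * n → 1 ≤ joinLabel h e sd c × joinLabel h e sd c ≤ 2 * P
  joinLabel-range h e zero          c h<Q e<2 _ c<2n =
    complementIf-range (isLarge (role e c)) (small-range (role e c) h (valid-role e c e<2 c<2n) h<Q)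
  joinLabel-range h e (suc zero)    c h<Q e<2 _ c<2n =
    complementIf-range (not (isLarge (role (flip e) c))) (small-range (role (flip e) c) h (valid-role (flip e) c (flip<2 e) c<2n) h<Q)
  joinLabel-range h e (suc (suc _)) c _ _ (s≤s (s≤s ())) _

  -- A, B and s κ are pairwise distinct: C is odd, and A, B are not multiples of C.
  A≢B : A ≢ B
  A≢B A≡B = 1+n≢0 (sym (proj₂ (*+-injective 2 {ρ} {P} (s≤s z≤n) (s≤s (s≤s z≤n)) (begin
    ρ * 2 + 0      ≡⟨ double ρ ⟩
    ρ + ρ          ≡⟨ cong (_+ ρ) (+-cancelˡ-≡ (n * C) ρ (C ∸ ρ) A≡B) ⟩
    C ∸ ρ + ρ      ≡⟨ m∸n+n≡m (<⇒≤ ρ<C) ⟩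
    C              ≡⟨ odd P ⟩
    P * 2 + 1      ∎))))
    where
    open ≡-Reasoning
    double : ∀ x → x * 2 + 0 ≡ x + x
    double x = solve (x List.∷ List.[])
    odd : ∀ x → suc (2 * x) ≡ x * 2 + 1
    odd x = solve (x List.∷ List.[])

  private
    sκ≡ : suc s * κ ≡ (suc s * 2) * C + 0
    sκ≡ = lemma s C
      where
      lemma : ∀ s C → suc s * (C + C) ≡ (suc s * 2) * C + 0
      lemma s C = solve (s List.∷ C List.∷ List.[])

    0<ρ : 0 < ρ
    0<ρ = subst (0 <_) (+-comm 1 (3 * Q * m + 9 * Q)) (s≤s z≤n)

  A≢sκ : A ≢ suc s * κ
  A≢sκ A≡sκ = <⇒≢ 0<ρ (sym (proj₂ (*+-injective C {n} {suc s * 2} ρ<C (s≤s z≤n) (trans A≡sκ sκ≡))))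

  B≢sκ : B ≢ suc s * κ
  B≢sκ B≡sκ = <⇒≢ ρ<C (sym C≡ρ)
    where
    C∸ρ≡0 : C ∸ ρ ≡ 0
    C∸ρ≡0 = proj₂ (*+-injective C {n} {suc s * 2} (∸-monoʳ-< {C} {ρ} {0} 0<ρ (<⇒≤ ρ<C)) (s≤s z≤n) (trans B≡sκ sκ≡))
    C≡ρ : C ≡ ρ
    C≡ρ = ≤-antisym (m∸n≡0⇒m≤n C∸ρ≡0) (<⇒≤ ρ<C)

design₂₊ : ∀ m r s → BlockDesign (suc (suc m)) (suc r) (suc s)
design₂₊ m r s = record
  { matchLabel = matchLabel ; joinLabel = joinLabel ; A = A ; B = B ; κ = κ
  ; x-sum = x-sum ; y-sum = y-sum ; z-sum = z-sum
  ; A≢B = A≢B ; A≢sκ = A≢sκ ; B≢sκ = B≢sκ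
  ; decode = decode ; decode-matchLabel = decode-matchLabel ; decode-joinLabel = decode-joinLabel
  ; matchLabel-range = matchLabel-range ; joinLabel-range = joinLabel-range
  }
  where open DesignTwoPlus m r s

theorem2p3 : (n r s : ℕ) → 1 ≤ n → 2 ≤ r → 1 ≤ s →
    ChiLaEq (copies r (copies (2 * s) P₂ ∨ᵍ O (2 * n))) 3
theorem2p3 (suc zero)    (suc r) (suc s) _ _ _ = blockDesign⇒χla≡3 (design₁ r s)
theorem2p3 (suc (suc m)) (suc r) (suc s) _ _ _ = blockDesign⇒χla≡3 (design₂₊ m r s)
theorem2p3 zero          _       _       () _  _
theorem2p3 (suc _)       zero    _       _  () _
theorem2p3 (suc _)       (suc _) zero    _  _  ()
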